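{- For $n\ge 1$, let $V=\mathbb{C}e_1\oplus\cdots\oplus\mathbb{C}e_n$ be the $n$-dimensional permutation representation of $S_n$, let $\chi_N$ be the character of the symmetric power $S^NV$, and let $D(n)$ be the dimension of the space of class functions on $S_n$ spanned by all $\chi_N$, $N\ge0$; set $D(0)=1$. Let $\phi$ be Euler's totient function. Then for every $n\ge 1$, $$D(n)\le \frac{n(n-1)}{2}+1-\sum_{j=1}^{n}\max\left(0,\ \phi(j)-D\left(n-j\left\lfloor \tfrac{n}{j}\right\rfloor\right)\right).$$
   Context: Equivalently, $D(m)$ is the dimension of the complex span in $\mathbb{C}[[q]]$ of the series $1/\prod_i(1-q^{\lambda_i})$ over all partitions $\lambda$ of $m$; for $m=0$ this span is spanned by the constant $1$, giving $D(0)=1$. -}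

module Defs where

open import Data.Nat using (ℕ; zero; suc; _+_; _*_; _∸_; _≤_; _≡ᵇ_; NonZero)
open import Data.Nat.GCD using (gcd)
open import Data.Nat.DivMod using (_%_; _/_)
open import Data.Bool using (if_then_else_)
open import Data.List using (List; []; _∷_; foldr; map; upTo; length; filterᵇ)
open import Data.Nat.ListAction using (sum)
open import Data.List.Relation.Unary.All using (All)
open import Data.Fin using (Fin; toℕ)
open import Data.Product using (Σ; _×_; ∃)
open import Data.Integer using (+_)
open import Data.Rational as ℚ using (ℚ; 0ℚ)
open import Relation.Binary.PropositionalEquality using (_≡_)
open import Relation.Nullary using (¬_)

-- Formal power series over ℕ, represented by their coefficient functions.
Series : Set
Series = ℕ → ℕ

sumTo : ℕ → (ℕ → ℕ) → ℕ
sumTo zero f = f 0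
sumTo (suc k) f = sumTo k f + f (suc k)

conv : Series → Series → Series
conv f g k = sumTo k (λ i → f i * g (k ∸ i))

oneSeries : Series
oneSeries zero = 1
oneSeries (suc _) = 0

-- 1 / (1 - q^p)  for p ≥ 1  (coefficient of q^k is 1 iff p ∣ k)
geom : (p : ℕ) → .{{NonZero p}} → Series
geom p k = if (k % p) ≡ᵇ 0 then 1 else 0

-- 1 / ∏_i (1 - q^{λ_i}) for a list of positive parts
invProd : List ℕ → Series
invProd [] = oneSeries
invProd (zero ∷ ps) = invProd ps   -- never used: parts of partitions are positive
invProd (suc p ∷ ps) = conv (geom (suc p)) (invProd ps)

-- Partitions of m: lists of positive integers summing to m (order irrelevant
-- for invProd, so unordered lists give the same set of series).
Partition : ℕ → Set
Partition m = Σ (List ℕ) λ l → All (1 ≤_) l × sum l ≡ m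

sumFinℚ : (r : ℕ) → (Fin r → ℚ) → ℚ
sumFinℚ zero f = 0ℚ
sumFinℚ (suc r) f = f Fin.zero ℚ.+ sumFinℚ r (λ i → f (Fin.suc i))

toℚ : ℕ → ℚ
toℚ n = (+ n) ℚ./ 1

LinIndep : (r : ℕ) → (Fin r → Series) → Set
LinIndep r f = (c : Fin r → ℚ) →
  (∀ k → sumFinℚ r (λ i → c i ℚ.* toℚ (f i k)) ≡ 0ℚ) → ∀ i → c i ≡ 0ℚ

-- d is the dimension of the span of { 1/∏(1-q^{λ_i}) : λ ⊢ m }
IsSpanDim : ℕ → ℕ → Set
IsSpanDim m d =
  (Σ (Fin d → Partition m) λ ls → LinIndep d (λ i → invProd (Σ.proj₁ (ls i))))
  × ((ls : Fin (suc d) → Partition m) → ¬ LinIndep (suc d) (λ i → invProd (Σ.proj₁ (ls i))))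

φ : ℕ → ℕ
φ j = length (filterᵇ (λ k → gcd k j ≡ᵇ 1) (map suc (upTo j)))

-- Σ_{j=1}^{n} max(0, φ(j) − D(n − j⌊n/j⌋))   (truncated ∸ is max(0,·))
correction : (ℕ → ℕ) → ℕ → ℕ
correction D n = sum (map (λ i → φ (suc i) ∸ D (n ∸ (suc i * (n / suc i)))) (upTo n))

{-# OPTIONS --safe #-}

-- Let Q = ∏_{k=1}^n (1 - X^k) and f_λ = 1/∏ᵢ (1 - X^λᵢ) for λ ⊢ n. Every Q f_λ is a polynomial of degree
-- n(n+1)/2 - n = n(n-1)/2, which alone gives D(n) ≤ n(n-1)/2 + 1. Call j deficient when D(n mod j) < φ(j),
-- and let C be the product of the cyclotomic polynomials Φ_j over the deficient j ≤ n. As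
-- 1 - X^k = ∏_{j ∣ k} Φ_j, Φ_j divides Q exactly ⌊n/j⌋ times and Q f_λ at least ⌊n/j⌋ - m_j(λ) times,
-- where m_j(λ) is the number of parts of λ divisible by j. If m_j(λ) < ⌊n/j⌋ for every deficient j, then
-- C divides Q f_λ and f_λ lies in the (T + 1)-dimensional space {P C/Q : deg P ≤ T}, T = n(n-1)/2 - deg C.
-- Otherwise, for some deficient j, λ consists of ⌊n/j⌋ parts equal to j and a partition μ of n mod j,
-- so f_λ = (1 - X^j)^(-⌊n/j⌋) f_μ lies in a space of dimension D(n mod j). Since deg C is the sum of
-- φ(j) over the deficient j, the dimensions add up to n(n-1)/2 + 1 - ∑_j max(0, φ(j) - D(n mod j)).

module Submission where

module PowerSeries where

  open import Algebra.Bundles using (CommutativeMonoid; CommutativeRing)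
  open import Algebra.Structures using (IsCommutativeRing)
  open import Algebra.Solver.Ring.AlmostCommutativeRing as ACR
    using (AlmostCommutativeRing; _-Raw-AlmostCommutative⟶_)
  import Algebra.Solver.Ring as RingSolver
  open import Data.Empty using (⊥-elim)
  open import Data.Maybe using (Maybe; just; nothing)
  open import Data.Nat as ℕ using (ℕ; zero; suc)
  open import Data.Product using (_,_)
  open import Data.Rational using (ℚ; 0ℚ; 1ℚ; _+_; _*_; -_)
  open import Data.Rational.Properties
  open import Data.Rational.Solver using (module +-*-Solver)
  open import Function using (_∘_)
  open import Relation.Binary.Bundles using (Setoid)
  open import Relation.Binary.Structures using (IsEquivalence)
  open import Relation.Binary.PropositionalEquality
  open import Relation.Nullary using (yes; no)
  open import Algebra.Properties.CommutativeSemigroup (CommutativeMonoid.commutativeSemigroup +-0-commutativeMonoid)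
    using () renaming (interchange to +-interchange)

  PowerSeries : Set
  PowerSeries = ℕ → ℚ

  infix 4 _≈_
  _≈_ : PowerSeries → PowerSeries → Set
  f ≈ g = ∀ k → f k ≡ g k

  ≈-refl : ∀ {f} → f ≈ f
  ≈-refl k = refl

  ≈-reflexive : ∀ {f g} → f ≡ g → f ≈ g
  ≈-reflexive refl = ≈-refl

  ≈-sym : ∀ {f g} → f ≈ g → g ≈ f
  ≈-sym f≈g k = sym (f≈g k)

  ≈-trans : ∀ {f g h} → f ≈ g → g ≈ h → f ≈ h
  ≈-trans f≈g g≈h k = trans (f≈g k) (g≈h k)

  ≈-isEquivalence : IsEquivalence _≈_
  ≈-isEquivalence = record { refl = ≈-refl ; sym = ≈-sym ; trans = ≈-trans }

  ≈-setoid : Setoid _ _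
  ≈-setoid = record { isEquivalence = ≈-isEquivalence }

  infixl 6 _⊕_ _⊖_
  infixl 7 _⊛_
  infixr 8 _·_
  infix 9 ⊝_

  -- Defined by cases, rather than as a · 1ₛ, so that the ring solver's constant 1 is 1ₛ itself.
  const : ℚ → PowerSeries
  const a zero = a
  const a (suc _) = 0ℚ

  0ₛ : PowerSeries
  0ₛ _ = 0ℚ

  1ₛ : PowerSeries
  1ₛ = const 1ℚ

  _⊕_ : PowerSeries → PowerSeries → PowerSeries
  (f ⊕ g) k = f k + g k

  ⊝_ : PowerSeries → PowerSeries
  (⊝ f) k = - f k

  _⊖_ : PowerSeries → PowerSeries → PowerSeries
  f ⊖ g = f ⊕ ⊝ g

  _·_ : ℚ → PowerSeries → PowerSeries
  (a · f) k = a * f k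

  _⊛_ : PowerSeries → PowerSeries → PowerSeries
  (f ⊛ g) zero = f 0 * g 0
  (f ⊛ g) (suc k) = f 0 * g (suc k) + ((f ∘ suc) ⊛ g) k

  shift : PowerSeries → PowerSeries
  shift f zero = 0ℚ
  shift f (suc k) = f k

  X^_ : ℕ → PowerSeries
  X^ zero = 1ₛ
  X^ suc t = shift (X^ t)

  ⊕-cong : ∀ {f f′ g g′} → f ≈ f′ → g ≈ g′ → f ⊕ g ≈ f′ ⊕ g′
  ⊕-cong f≈f′ g≈g′ k = cong₂ _+_ (f≈f′ k) (g≈g′ k)

  ⊕-congˡ : ∀ f {g g′} → g ≈ g′ → f ⊕ g ≈ f ⊕ g′
  ⊕-congˡ f g≈g′ k = cong (f k +_) (g≈g′ k)

  ⊕-congʳ : ∀ {f f′} g → f ≈ f′ → f ⊕ g ≈ f′ ⊕ g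
  ⊕-congʳ g f≈f′ k = cong (_+ g k) (f≈f′ k)

  ⊝-cong : ∀ {f g} → f ≈ g → ⊝ f ≈ ⊝ g
  ⊝-cong f≈g k = cong -_ (f≈g k)

  ·-congʳ : ∀ a {f g} → f ≈ g → a · f ≈ a · g
  ·-congʳ a f≈g k = cong (a *_) (f≈g k)

  shift-cong : ∀ {f g} → f ≈ g → shift f ≈ shift g
  shift-cong f≈g zero = refl
  shift-cong f≈g (suc k) = f≈g k

  ⊛-congˡ : ∀ f {g g′} → g ≈ g′ → f ⊛ g ≈ f ⊛ g′
  ⊛-congˡ f g≈g′ zero = cong (f 0 *_) (g≈g′ 0)
  ⊛-congˡ f g≈g′ (suc k) = cong₂ _+_ (cong (f 0 *_) (g≈g′ (suc k))) (⊛-congˡ (f ∘ suc) g≈g′ k)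

  ⊛-congʳ : ∀ {f f′} g → f ≈ f′ → f ⊛ g ≈ f′ ⊛ g
  ⊛-congʳ g f≈f′ zero = cong (_* g 0) (f≈f′ 0)
  ⊛-congʳ g f≈f′ (suc k) =
    cong₂ _+_ (cong (_* g (suc k)) (f≈f′ 0)) (⊛-congʳ g (f≈f′ ∘ suc) k)

  ⊛-cong : ∀ {f f′ g g′} → f ≈ f′ → g ≈ g′ → f ⊛ g ≈ f′ ⊛ g′
  ⊛-cong {f′ = f′} {g} f≈f′ g≈g′ = ≈-trans (⊛-congʳ g f≈f′) (⊛-congˡ f′ g≈g′)

  ⊕-assoc : ∀ f g h → (f ⊕ g) ⊕ h ≈ f ⊕ (g ⊕ h)
  ⊕-assoc f g h k = +-assoc (f k) (g k) (h k)

  ⊕-comm : ∀ f g → f ⊕ g ≈ g ⊕ f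
  ⊕-comm f g k = +-comm (f k) (g k)

  ⊕-identityˡ : ∀ f → 0ₛ ⊕ f ≈ f
  ⊕-identityˡ f k = +-identityˡ (f k)

  ⊕-identityʳ : ∀ f → f ⊕ 0ₛ ≈ f
  ⊕-identityʳ f k = +-identityʳ (f k)

  ⊝-inverseˡ : ∀ f → ⊝ f ⊕ f ≈ 0ₛ
  ⊝-inverseˡ f k = +-inverseˡ (f k)

  ⊝-inverseʳ : ∀ f → f ⊕ ⊝ f ≈ 0ₛ
  ⊝-inverseʳ f k = +-inverseʳ (f k)

  ⊛-zeroˡ : ∀ g → 0ₛ ⊛ g ≈ 0ₛ
  ⊛-zeroˡ g zero = *-zeroˡ (g 0)
  ⊛-zeroˡ g (suc k) = trans (cong₂ _+_ (*-zeroˡ (g (suc k))) (⊛-zeroˡ g k)) (+-identityˡ 0ℚ)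

  ⊛-zeroʳ : ∀ f → f ⊛ 0ₛ ≈ 0ₛ
  ⊛-zeroʳ f zero = *-zeroʳ (f 0)
  ⊛-zeroʳ f (suc k) = trans (cong₂ _+_ (*-zeroʳ (f 0)) (⊛-zeroʳ (f ∘ suc) k)) (+-identityˡ 0ℚ)

  const-⊛ : ∀ a g → const a ⊛ g ≈ a · g
  const-⊛ a g zero = refl
  const-⊛ a g (suc k) = trans (cong (a * g (suc k) +_) (⊛-zeroˡ g k)) (+-identityʳ (a * g (suc k)))

  ⊛-identityˡ : ∀ g → 1ₛ ⊛ g ≈ g
  ⊛-identityˡ g k = trans (const-⊛ 1ℚ g k) (*-identityˡ (g k))

  ⊛-distribʳ : ∀ g f f′ → (f ⊕ f′) ⊛ g ≈ f ⊛ g ⊕ f′ ⊛ g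
  ⊛-distribʳ g f f′ zero = *-distribʳ-+ (g 0) (f 0) (f′ 0)
  ⊛-distribʳ g f f′ (suc k) =
    trans (cong₂ _+_ (*-distribʳ-+ (g (suc k)) (f 0) (f′ 0)) (⊛-distribʳ g (f ∘ suc) (f′ ∘ suc) k))
          (+-interchange (f 0 * g (suc k)) (f′ 0 * g (suc k)) (((f ∘ suc) ⊛ g) k) (((f′ ∘ suc) ⊛ g) k))

  ·-⊛ : ∀ a f g → (a · f) ⊛ g ≈ a · (f ⊛ g)
  ·-⊛ a f g zero = *-assoc a (f 0) (g 0)
  ·-⊛ a f g (suc k) =
    trans (cong₂ _+_ (*-assoc a (f 0) (g (suc k))) (·-⊛ a (f ∘ suc) g k))
          (sym (*-distribˡ-+ a (f 0 * g (suc k)) (((f ∘ suc) ⊛ g) k)))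

  ⊛-suc : ∀ f g k → (f ⊛ g) (suc k) ≡ (f ⊛ (g ∘ suc)) k + f (suc k) * g 0
  ⊛-suc f g zero = refl
  ⊛-suc f g (suc k) =
    trans (cong (f 0 * g (suc (suc k)) +_) (⊛-suc (f ∘ suc) g k))
          (sym (+-assoc (f 0 * g (suc (suc k))) (((f ∘ suc) ⊛ (g ∘ suc)) k) (f (suc (suc k)) * g 0)))

  ⊛-comm : ∀ f g → f ⊛ g ≈ g ⊛ f
  ⊛-comm f g zero = *-comm (f 0) (g 0)
  ⊛-comm f g (suc k) =
    trans (cong₂ _+_ (*-comm (f 0) (g (suc k))) (⊛-comm (f ∘ suc) g k))
          (trans (+-comm (g (suc k) * f 0) ((g ⊛ (f ∘ suc)) k)) (sym (⊛-suc g f k)))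

  ⊛-identityʳ : ∀ f → f ⊛ 1ₛ ≈ f
  ⊛-identityʳ f = ≈-trans (⊛-comm f 1ₛ) (⊛-identityˡ f)

  ⊛-distribˡ : ∀ f g g′ → f ⊛ (g ⊕ g′) ≈ f ⊛ g ⊕ f ⊛ g′
  ⊛-distribˡ f g g′ k =
    trans (⊛-comm f (g ⊕ g′) k)
          (trans (⊛-distribʳ f g g′ k) (cong₂ _+_ (⊛-comm g f k) (⊛-comm g′ f k)))

  ⊛-· : ∀ a f g → f ⊛ (a · g) ≈ a · (f ⊛ g)
  ⊛-· a f g k = trans (⊛-comm f (a · g) k) (trans (·-⊛ a g f k) (cong (a *_) (⊛-comm g f k)))

  ⊛-assoc : ∀ f g h → (f ⊛ g) ⊛ h ≈ f ⊛ (g ⊛ h)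
  ⊛-assoc f g h zero = *-assoc (f 0) (g 0) (h 0)
  ⊛-assoc f g h (suc k) =
    trans (cong (f 0 * g 0 * h (suc k) +_)
            (trans (⊛-distribʳ h (f 0 · (g ∘ suc)) ((f ∘ suc) ⊛ g) k)
                   (cong₂ _+_ (·-⊛ (f 0) (g ∘ suc) h k) (⊛-assoc (f ∘ suc) g h k))))
          (regroup (f 0) (g 0) (h (suc k)) (((g ∘ suc) ⊛ h) k) (((f ∘ suc) ⊛ (g ⊛ h)) k))
    where
    regroup : ∀ a b c x y → a * b * c + (a * x + y) ≡ a * (b * c + x) + y
    regroup = solve 5 (λ a b c x y → a :* b :* c :+ (a :* x :+ y) := a :* (b :* c :+ x) :+ y) refl
      where open +-*-Solver

  shift-⊛ : ∀ f g → shift f ⊛ g ≈ shift (f ⊛ g)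
  shift-⊛ f g zero = *-zeroˡ (g 0)
  shift-⊛ f g (suc k) = trans (cong (_+ (f ⊛ g) k) (*-zeroˡ (g (suc k)))) (+-identityˡ _)

  X^-+ : ∀ a b → X^ a ⊛ X^ b ≈ X^ (a ℕ.+ b)
  X^-+ zero b = ⊛-identityˡ (X^ b)
  X^-+ (suc a) b = ≈-trans (shift-⊛ (X^ a) (X^ b)) (shift-cong (X^-+ a b))

  isCommutativeRing : IsCommutativeRing _≈_ _⊕_ _⊛_ ⊝_ 0ₛ 1ₛ
  isCommutativeRing = record
    { isRing = record
      { +-isAbelianGroup = record
        { isGroup = record
          { isMonoid = record
            { isSemigroup = record
              { isMagma = record { isEquivalence = ≈-isEquivalence ; ∙-cong = ⊕-cong }
              ; assoc = ⊕-assoc }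
            ; identity = ⊕-identityˡ , ⊕-identityʳ }
          ; inverse = ⊝-inverseˡ , ⊝-inverseʳ
          ; ⁻¹-cong = ⊝-cong }
        ; comm = ⊕-comm }
      ; *-cong = ⊛-cong
      ; *-assoc = ⊛-assoc
      ; *-identity = ⊛-identityˡ , ⊛-identityʳ
      ; distrib = (λ f g h → ⊛-distribˡ f g h) , (λ f g h → ⊛-distribʳ f g h) }
    ; *-comm = ⊛-comm }

  commutativeRing : CommutativeRing _ _
  commutativeRing = record { isCommutativeRing = isCommutativeRing }

  ·-const : ∀ a b → a · const b ≈ const (a * b)
  ·-const a b zero = refl
  ·-const a b (suc k) = *-zeroʳ a

  const-* : ∀ a b → const (a * b) ≈ const a ⊛ const b
  const-* a b = ≈-sym (≈-trans (const-⊛ a (const b)) (·-const a b))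

  const-homomorphism : CommutativeRing.rawRing +-*-commutativeRing
                         -Raw-AlmostCommutative⟶ ACR.fromCommutativeRing commutativeRing
  const-homomorphism = record
    { ⟦_⟧ = const
    ; +-homo = const-+
    ; *-homo = const-*
    ; -‿homo = const-neg
    ; 0-homo = const-0
    ; 1-homo = ≈-refl }
    where
    const-+ : ∀ a b → const (a + b) ≈ const a ⊕ const b
    const-+ a b zero = refl
    const-+ a b (suc k) = sym (+-identityˡ 0ℚ)
    const-neg : ∀ a → const (- a) ≈ ⊝ const a
    const-neg a zero = refl
    const-neg a (suc k) = refl
    const-0 : const 0ℚ ≈ 0ₛ
    const-0 zero = refl
    const-0 (suc k) = refl

  const-≟ : ∀ a b → Maybe (const a ≈ const b)
  const-≟ a b with a ≟ b
  ... | yes refl = just ≈-refl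
  ... | no _ = nothing

  module Solver = RingSolver (CommutativeRing.rawRing +-*-commutativeRing)
    (ACR.fromCommutativeRing commutativeRing) const-homomorphism const-≟

  infixr 8 _⊛^_
  _⊛^_ : PowerSeries → ℕ → PowerSeries
  f ⊛^ zero = 1ₛ
  f ⊛^ suc e = f ⊛ f ⊛^ e

  ⊛^-congˡ : ∀ {f g} e → f ≈ g → f ⊛^ e ≈ g ⊛^ e
  ⊛^-congˡ zero f≈g = ≈-refl
  ⊛^-congˡ (suc e) f≈g = ⊛-cong f≈g (⊛^-congˡ e f≈g)

  ⊛^-+ : ∀ f a b → f ⊛^ (a ℕ.+ b) ≈ f ⊛^ a ⊛ f ⊛^ b
  ⊛^-+ f zero b = ≈-sym (⊛-identityˡ (f ⊛^ b))
  ⊛^-+ f (suc a) b = ≈-trans (⊛-congˡ f (⊛^-+ f a b)) (≈-sym (⊛-assoc f (f ⊛^ a) (f ⊛^ b)))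

  X^-diag : ∀ t → (X^ t) t ≡ 1ℚ
  X^-diag zero = refl
  X^-diag (suc t) = X^-diag t

  X^-off-diag : ∀ t k → t ≢ k → (X^ t) k ≡ 0ℚ
  X^-off-diag zero zero t≢k = ⊥-elim (t≢k refl)
  X^-off-diag zero (suc k) t≢k = refl
  X^-off-diag (suc t) zero t≢k = refl
  X^-off-diag (suc t) (suc k) t≢k = X^-off-diag t k (t≢k ∘ cong suc)

  X^-⊛-below : ∀ p f k → k ℕ.< p → (X^ p ⊛ f) k ≡ 0ℚ
  X^-⊛-below (suc p) f zero _ = *-zeroˡ (f 0)
  X^-⊛-below (suc p) f (suc k) (ℕ.s≤s k<p) = trans (shift-⊛ (X^ p) f (suc k)) (X^-⊛-below p f k k<p)

  X^-⊛-shifted : ∀ p f k → (X^ p ⊛ f) (p ℕ.+ k) ≡ f k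
  X^-⊛-shifted zero f k = ⊛-identityˡ f k
  X^-⊛-shifted (suc p) f k = trans (shift-⊛ (X^ p) f (suc (p ℕ.+ k))) (X^-⊛-shifted p f k)

  ⊛-distribʳ-⊖ : ∀ h f g → (f ⊖ g) ⊛ h ≈ f ⊛ h ⊖ g ⊛ h
  ⊛-distribʳ-⊖ h f g = solve 3 (λ f g h → (f :- g) :* h := f :* h :- g :* h) ≈-refl f g h
    where open Solver

  ⊛-distribˡ-⊖ : ∀ h f g → h ⊛ (f ⊖ g) ≈ h ⊛ f ⊖ h ⊛ g
  ⊛-distribˡ-⊖ h f g = solve 3 (λ f g h → h :* (f :- g) := h :* f :- h :* g) ≈-refl f g h
    where open Solver

module Polynomial where

  open import Data.Empty using (⊥-elim)
  open import Data.Nat as ℕ using (ℕ; zero; suc; _≤_; _<_; z≤n; s≤s)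
  import Data.Nat.Properties as ℕ
  open import Data.Product using (∃; ∃₂; _×_; _,_; proj₁)
  open import Data.Rational as ℚ using (ℚ; 0ℚ; 1ℚ; _+_; _*_; -_)
  open import Data.Rational.Properties
  open import Data.Sum using (inj₁; inj₂)
  open import Function using (_∘_)
  open import Relation.Binary using (tri<; tri≈; tri>)
  open import Relation.Binary.PropositionalEquality
  import Relation.Binary.Reasoning.Setoid as SetoidReasoning
  open import Relation.Nullary using (yes; no)

  open PowerSeries
  open Solver using (solve; _:=_; _:+_; _:*_)

  *-≢0 : ∀ {a b} → a ≢ 0ℚ → b ≢ 0ℚ → a * b ≢ 0ℚ
  *-≢0 {a} {b} a≢0 b≢0 ab≡0 = b≢0 (begin
    b                  ≡⟨ sym (*-identityˡ b) ⟩
    1ℚ * b             ≡⟨ cong (_* b) (sym (*-inverseˡ a)) ⟩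
    ℚ.1/ a * a * b     ≡⟨ *-assoc (ℚ.1/ a) a b ⟩
    ℚ.1/ a * (a * b)   ≡⟨ cong (ℚ.1/ a *_) ab≡0 ⟩
    ℚ.1/ a * 0ℚ        ≡⟨ *-zeroʳ (ℚ.1/ a) ⟩
    0ℚ                 ∎)
    where
    open ≡-Reasoning
    instance
      a-nonZero : ℚ.NonZero a
      a-nonZero = ℚ.≢-nonZero a≢0

  ≢0∧*≡0⇒≡0 : ∀ {a b} → a ≢ 0ℚ → a * b ≡ 0ℚ → b ≡ 0ℚ
  ≢0∧*≡0⇒≡0 {b = b} a≢0 ab≡0 with b ≟ 0ℚ
  ... | yes b≡0 = b≡0
  ... | no b≢0 = ⊥-elim (*-≢0 a≢0 b≢0 ab≡0)

  Deg≤ : PowerSeries → ℕ → Set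
  Deg≤ f d = ∀ k → d < k → f k ≡ 0ℚ

  HasDegree : PowerSeries → ℕ → Set
  HasDegree f d = Deg≤ f d × f d ≢ 0ℚ

  IsPolynomial : PowerSeries → Set
  IsPolynomial f = ∃ (Deg≤ f)

  Deg≤-resp-≈ : ∀ {f g d} → f ≈ g → Deg≤ f d → Deg≤ g d
  Deg≤-resp-≈ f≈g f≤d k d<k = trans (sym (f≈g k)) (f≤d k d<k)

  Deg≤-mono : ∀ {f d e} → d ≤ e → Deg≤ f d → Deg≤ f e
  Deg≤-mono d≤e f≤d k e<k = f≤d k (ℕ.≤-<-trans d≤e e<k)

  Deg≤-⊕ : ∀ {f g d} → Deg≤ f d → Deg≤ g d → Deg≤ (f ⊕ g) d
  Deg≤-⊕ f≤d g≤d k d<k = trans (cong₂ _+_ (f≤d k d<k) (g≤d k d<k)) (+-identityˡ 0ℚ)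

  Deg≤-· : ∀ a {f d} → Deg≤ f d → Deg≤ (a · f) d
  Deg≤-· a f≤d k d<k = trans (cong (a *_) (f≤d k d<k)) (*-zeroʳ a)

  Deg≤0-⊛ : ∀ f g → Deg≤ f 0 → f ⊛ g ≈ f 0 · g
  Deg≤0-⊛ f g f≤0 zero = refl
  Deg≤0-⊛ f g f≤0 (suc k) =
    trans (cong (f 0 * g (suc k) +_)
            (trans (⊛-congʳ g (λ i → f≤0 (suc i) (s≤s z≤n)) k) (⊛-zeroˡ g k)))
          (+-identityʳ _)

  Deg≤-⊛ : ∀ {f g} a b → Deg≤ f a → Deg≤ g b → Deg≤ (f ⊛ g) (a ℕ.+ b)
  Deg≤-⊛ {f} {g} zero b f≤0 g≤b k b<k =
    trans (Deg≤0-⊛ f g f≤0 k) (trans (cong (f 0 *_) (g≤b k b<k)) (*-zeroʳ (f 0)))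
  Deg≤-⊛ {f} {g} (suc a) b f≤a g≤b (suc k) (s≤s a+b<k) =
    trans (cong₂ _+_ (trans (cong (f 0 *_) (g≤b (suc k) (s≤s (ℕ.≤-trans (ℕ.m≤n+m b a) (ℕ.<⇒≤ a+b<k)))))
                            (*-zeroʳ (f 0)))
                     (Deg≤-⊛ a b (λ i a<i → f≤a (suc i) (s≤s a<i)) g≤b k a+b<k))
          (+-identityʳ 0ℚ)

  leadingCoeff-⊛ : ∀ {f g} a b → Deg≤ f a → Deg≤ g b → (f ⊛ g) (a ℕ.+ b) ≡ f a * g b
  leadingCoeff-⊛ {f} {g} zero b f≤0 g≤b = Deg≤0-⊛ f g f≤0 b
  leadingCoeff-⊛ {f} {g} (suc a) b f≤a g≤b =
    trans (cong₂ _+_ (trans (cong (f 0 *_) (g≤b (suc (a ℕ.+ b)) (s≤s (ℕ.m≤n+m b a)))) (*-zeroʳ (f 0)))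
                     (leadingCoeff-⊛ a b (λ i a<i → f≤a (suc i) (s≤s a<i)) g≤b))
          (+-identityˡ _)

  HasDegree-resp-≈ : ∀ {f g d} → f ≈ g → HasDegree f d → HasDegree g d
  HasDegree-resp-≈ f≈g (f≤d , fd≢0) = Deg≤-resp-≈ f≈g f≤d , λ gd≡0 → fd≢0 (trans (f≈g _) gd≡0)

  HasDegree-⊛ : ∀ {f g a b} → HasDegree f a → HasDegree g b → HasDegree (f ⊛ g) (a ℕ.+ b)
  HasDegree-⊛ {a = a} {b} (f≤a , fa≢0) (g≤b , gb≢0) =
    Deg≤-⊛ a b f≤a g≤b , λ fg≡0 → *-≢0 fa≢0 gb≢0 (trans (sym (leadingCoeff-⊛ a b f≤a g≤b)) fg≡0)

  HasDegree-unique : ∀ {f a b} → HasDegree f a → HasDegree f b → a ≡ b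
  HasDegree-unique {a = a} {b} (f≤a , fa≢0) (f≤b , fb≢0) with ℕ.<-cmp a b
  ... | tri< a<b _ _ = ⊥-elim (fb≢0 (f≤a b a<b))
  ... | tri≈ _ a≡b _ = a≡b
  ... | tri> _ _ b<a = ⊥-elim (fa≢0 (f≤b a b<a))

  HasDegree-1ₛ : HasDegree 1ₛ 0
  HasDegree-1ₛ = (λ { (suc k) _ → refl }) , λ ()

  HasDegree-⊛^ : ∀ {f d} e → HasDegree f d → HasDegree (f ⊛^ e) (e ℕ.* d)
  HasDegree-⊛^ zero f∈d = HasDegree-1ₛ
  HasDegree-⊛^ (suc e) f∈d = HasDegree-⊛ f∈d (HasDegree-⊛^ e f∈d)

  nonzero⇒HasDegree : ∀ {f} d → Deg≤ f d → ∀ {k} → f k ≢ 0ℚ → ∃ (HasDegree f)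
  nonzero⇒HasDegree {f} d f≤d {k} fk≢0 with f d ≟ 0ℚ
  ... | no fd≢0 = d , f≤d , fd≢0
  nonzero⇒HasDegree {f} zero f≤0 {zero} fk≢0 | yes f0≡0 = ⊥-elim (fk≢0 f0≡0)
  nonzero⇒HasDegree {f} zero f≤0 {suc k} fk≢0 | yes _ = ⊥-elim (fk≢0 (f≤0 (suc k) (s≤s z≤n)))
  nonzero⇒HasDegree {f} (suc d) f≤1+d fk≢0 | yes f[1+d]≡0 = nonzero⇒HasDegree d f≤d fk≢0
    where
    f≤d : Deg≤ f d
    f≤d k d<k with ℕ.m≤n⇒m<n∨m≡n d<k
    ... | inj₁ 1+d<k = f≤1+d k 1+d<k
    ... | inj₂ refl = f[1+d]≡0

  IsPolynomial-0ₛ : IsPolynomial 0ₛ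
  IsPolynomial-0ₛ = 0 , λ _ _ → refl

  IsPolynomial-1ₛ : IsPolynomial 1ₛ
  IsPolynomial-1ₛ = 0 , proj₁ HasDegree-1ₛ

  IsPolynomial-X^ : ∀ t → IsPolynomial (X^ t)
  IsPolynomial-X^ zero = IsPolynomial-1ₛ
  IsPolynomial-X^ (suc t) with IsPolynomial-X^ t
  ... | d , X^t≤d = suc d , λ { (suc k) (s≤s d<k) → X^t≤d k d<k }

  IsPolynomial-⊕ : ∀ {f g} → IsPolynomial f → IsPolynomial g → IsPolynomial (f ⊕ g)
  IsPolynomial-⊕ (a , f≤a) (b , g≤b) =
    a ℕ.+ b , Deg≤-⊕ (Deg≤-mono (ℕ.m≤m+n a b) f≤a) (Deg≤-mono (ℕ.m≤n+m b a) g≤b)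

  IsPolynomial-· : ∀ c {f} → IsPolynomial f → IsPolynomial (c · f)
  IsPolynomial-· c (a , f≤a) = a , Deg≤-· c f≤a

  IsPolynomial-⊝ : ∀ {f} → IsPolynomial f → IsPolynomial (⊝ f)
  IsPolynomial-⊝ (a , f≤a) = a , λ k a<k → cong -_ (f≤a k a<k)

  IsPolynomial-⊛ : ∀ {f g} → IsPolynomial f → IsPolynomial g → IsPolynomial (f ⊛ g)
  IsPolynomial-⊛ (a , f≤a) (b , g≤b) = a ℕ.+ b , Deg≤-⊛ a b f≤a g≤b

  IsPolynomial-⊛^ : ∀ {f} e → IsPolynomial f → IsPolynomial (f ⊛^ e)
  IsPolynomial-⊛^ zero f-poly = IsPolynomial-1ₛ
  IsPolynomial-⊛^ (suc e) f-poly = IsPolynomial-⊛ f-poly (IsPolynomial-⊛^ e f-poly)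

  ⊛-vanishes : ∀ f g k → (∀ j → j ≤ k → f j ≡ 0ℚ) → (f ⊛ g) k ≡ 0ℚ
  ⊛-vanishes f g zero f≡0 = trans (cong (_* g 0) (f≡0 0 z≤n)) (*-zeroˡ (g 0))
  ⊛-vanishes f g (suc k) f≡0 =
    trans (cong₂ _+_ (trans (cong (_* g (suc k)) (f≡0 0 z≤n)) (*-zeroˡ (g (suc k))))
                     (⊛-vanishes (f ∘ suc) g k (λ j j≤k → f≡0 (suc j) (s≤s j≤k))))
          (+-identityˡ 0ℚ)

  ⊛-lowestCoeff : ∀ f g m → (∀ j → j < m → g j ≡ 0ℚ) → (f ⊛ g) m ≡ f 0 * g m
  ⊛-lowestCoeff f g zero g≡0 = refl
  ⊛-lowestCoeff f g (suc m) g≡0 = begin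
    (f ⊛ g) (suc m)                               ≡⟨ ⊛-comm f g (suc m) ⟩
    (g ⊛ f) (suc m)                               ≡⟨ ⊛-suc g f m ⟩
    (g ⊛ (f ∘ suc)) m + g (suc m) * f 0           ≡⟨ cong (_+ g (suc m) * f 0) (⊛-vanishes g (f ∘ suc) m (λ j j≤m → g≡0 j (s≤s j≤m))) ⟩
    0ℚ + g (suc m) * f 0                          ≡⟨ +-identityˡ _ ⟩
    g (suc m) * f 0                               ≡⟨ *-comm (g (suc m)) (f 0) ⟩
    f 0 * g (suc m)                               ∎
    where open ≡-Reasoning

  ⊛-noZeroDivisor : ∀ f {g} → f 0 ≢ 0ℚ → f ⊛ g ≈ 0ₛ → g ≈ 0ₛ
  ⊛-noZeroDivisor f {g} f₀≢0 fg≈0 k = vanishesBelow (suc k) k ℕ.≤-refl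
    where
    vanishesBelow : ∀ m j → j < m → g j ≡ 0ℚ
    vanishesBelow (suc m) j (s≤s j≤m) with ℕ.m≤n⇒m<n∨m≡n j≤m
    ... | inj₁ j<m = vanishesBelow m j j<m
    ... | inj₂ refl = ≢0∧*≡0⇒≡0 f₀≢0
          (trans (sym (⊛-lowestCoeff f g j (vanishesBelow j))) (fg≈0 j))

  ⊛-cancelˡ : ∀ f {g h} → f 0 ≢ 0ℚ → f ⊛ g ≈ f ⊛ h → g ≈ h
  ⊛-cancelˡ f {g} {h} f₀≢0 fg≈fh k = begin
    g k                     ≡⟨ +-identityʳ (g k) ⟨
    g k + 0ℚ                ≡⟨ cong (g k +_) (+-inverseˡ (h k)) ⟨
    g k + (- h k + h k)     ≡⟨ +-assoc (g k) (- h k) (h k) ⟨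
    (g k + - h k) + h k     ≡⟨ cong (_+ h k) (⊛-noZeroDivisor f f₀≢0 f[g-h]≈0 k) ⟩
    0ℚ + h k                ≡⟨ +-identityˡ (h k) ⟩
    h k                     ∎
    where
    open ≡-Reasoning
    f[g-h]≈0 : f ⊛ (g ⊖ h) ≈ 0ₛ
    f[g-h]≈0 = ≈-trans (⊛-distribˡ-⊖ f g h) (≈-trans (⊕-congʳ (⊝ (f ⊛ h)) fg≈fh) (⊝-inverseʳ (f ⊛ h)))

  infix 4 _∣ₚ_
  _∣ₚ_ : PowerSeries → PowerSeries → Set
  f ∣ₚ g = ∃ λ h → IsPolynomial h × f ⊛ h ≈ g

  Coprime : PowerSeries → PowerSeries → Set
  Coprime f g = ∃₂ λ u v → IsPolynomial u × IsPolynomial v × u ⊛ f ⊕ v ⊛ g ≈ 1ₛ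

  ∣ₚ-respˡ : ∀ {f f′ g} → f ≈ f′ → f ∣ₚ g → f′ ∣ₚ g
  ∣ₚ-respˡ f≈f′ (h , h-poly , fh≈g) = h , h-poly , ≈-trans (⊛-congʳ h (≈-sym f≈f′)) fh≈g

  ∣ₚ-respʳ : ∀ {f g g′} → g ≈ g′ → f ∣ₚ g → f ∣ₚ g′
  ∣ₚ-respʳ g≈g′ (h , h-poly , fh≈g) = h , h-poly , ≈-trans fh≈g g≈g′

  ∣ₚ-trans : ∀ {f g h} → f ∣ₚ g → g ∣ₚ h → f ∣ₚ h
  ∣ₚ-trans {f} (a , a-poly , fa≈g) (b , b-poly , gb≈h) =
    a ⊛ b , IsPolynomial-⊛ a-poly b-poly , ≈-trans (≈-sym (⊛-assoc f a b)) (≈-trans (⊛-congʳ b fa≈g) gb≈h)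

  1ₛ∣ₚ : ∀ {f} → IsPolynomial f → 1ₛ ∣ₚ f
  1ₛ∣ₚ {f} f-poly = f , f-poly , ⊛-identityˡ f

  Coprime-sym : ∀ {f g} → Coprime f g → Coprime g f
  Coprime-sym {f} {g} (u , v , u-poly , v-poly , uf+vg≈1) =
    v , u , v-poly , u-poly , ≈-trans (⊕-comm (v ⊛ g) (u ⊛ f)) uf+vg≈1

  Coprime-1ₛ : ∀ {f} → Coprime f 1ₛ
  Coprime-1ₛ {f} = 0ₛ , 1ₛ , IsPolynomial-0ₛ , IsPolynomial-1ₛ ,
    ≈-trans (⊕-cong (⊛-zeroˡ f) (⊛-identityˡ 1ₛ)) (⊕-identityˡ 1ₛ)

  Coprime-const : ∀ {f g u v} c → c ≢ 0ℚ → IsPolynomial u → IsPolynomial v →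
                  u ⊛ f ⊕ v ⊛ g ≈ const c → Coprime f g
  Coprime-const {f} {g} {u} {v} c c≢0 u-poly v-poly uf+vg≈c =
    c⁻¹ · u , c⁻¹ · v , IsPolynomial-· c⁻¹ u-poly , IsPolynomial-· c⁻¹ v-poly , scaled
    where
    instance
      c-nonZero : ℚ.NonZero c
      c-nonZero = ℚ.≢-nonZero c≢0
    c⁻¹ : ℚ
    c⁻¹ = ℚ.1/ c
    open SetoidReasoning ≈-setoid
    scaled : c⁻¹ · u ⊛ f ⊕ c⁻¹ · v ⊛ g ≈ 1ₛ
    scaled = begin
      c⁻¹ · u ⊛ f ⊕ c⁻¹ · v ⊛ g   ≈⟨ ⊕-cong (·-⊛ c⁻¹ u f) (·-⊛ c⁻¹ v g) ⟩
      c⁻¹ · (u ⊛ f) ⊕ c⁻¹ · (v ⊛ g) ≈⟨ (λ k → sym (*-distribˡ-+ c⁻¹ ((u ⊛ f) k) ((v ⊛ g) k))) ⟩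
      c⁻¹ · (u ⊛ f ⊕ v ⊛ g)       ≈⟨ ·-congʳ c⁻¹ uf+vg≈c ⟩
      c⁻¹ · const c                ≈⟨ ·-const c⁻¹ c ⟩
      const (c⁻¹ * c)              ≈⟨ ≈-reflexive (cong const (*-inverseˡ c)) ⟩
      1ₛ                           ∎

  Coprime-via-multiples : ∀ {f g a b u v} c → c ≢ 0ℚ → f ∣ₚ a → g ∣ₚ b → IsPolynomial u → IsPolynomial v →
                          u ⊛ a ⊕ v ⊛ b ≈ const c → Coprime f g
  Coprime-via-multiples {f} {g} {a} {b} {u} {v} c c≢0 (a′ , a′-poly , fa′≈a) (b′ , b′-poly , gb′≈b) u-poly v-poly ua+vb≈c =
    Coprime-const c c≢0 (IsPolynomial-⊛ u-poly a′-poly) (IsPolynomial-⊛ v-poly b′-poly) (begin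
      u ⊛ a′ ⊛ f ⊕ v ⊛ b′ ⊛ g
        ≈⟨ solve 6 (λ u a′ f v b′ g → u :* a′ :* f :+ v :* b′ :* g := u :* (f :* a′) :+ v :* (g :* b′))
                 ≈-refl u a′ f v b′ g ⟩
      u ⊛ (f ⊛ a′) ⊕ v ⊛ (g ⊛ b′)   ≈⟨ ⊕-cong (⊛-congˡ u fa′≈a) (⊛-congˡ v gb′≈b) ⟩
      u ⊛ a ⊕ v ⊛ b                 ≈⟨ ua+vb≈c ⟩
      const c                       ∎)
    where open SetoidReasoning ≈-setoid

  -- Multiplying the two Bézout identities gives one for f and g ⊛ g′.
  Coprime-⊛ʳ : ∀ {f g g′} → IsPolynomial f → IsPolynomial g → IsPolynomial g′ →
               Coprime f g → Coprime f g′ → Coprime f (g ⊛ g′)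
  Coprime-⊛ʳ {f} {g} {g′} f-poly g-poly g′-poly
    (u , v , u-poly , v-poly , uf+vg≈1) (u′ , v′ , u′-poly , v′-poly , u′f+v′g′≈1) =
    w , v ⊛ v′ , w-poly , IsPolynomial-⊛ v-poly v′-poly , identity
    where
    w : PowerSeries
    w = u ⊛ u′ ⊛ f ⊕ u ⊛ v′ ⊛ g′ ⊕ v ⊛ u′ ⊛ g
    w-poly : IsPolynomial w
    w-poly = IsPolynomial-⊕ (IsPolynomial-⊕ (IsPolynomial-⊛ (IsPolynomial-⊛ u-poly u′-poly) f-poly)
                                            (IsPolynomial-⊛ (IsPolynomial-⊛ u-poly v′-poly) g′-poly))
                            (IsPolynomial-⊛ (IsPolynomial-⊛ v-poly u′-poly) g-poly)
    open SetoidReasoning ≈-setoid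
    identity : w ⊛ f ⊕ (v ⊛ v′) ⊛ (g ⊛ g′) ≈ 1ₛ
    identity = begin
      w ⊛ f ⊕ (v ⊛ v′) ⊛ (g ⊛ g′)
        ≈⟨ solve 7 (λ f g g′ u v u′ v′ →
                      (u :* u′ :* f :+ u :* v′ :* g′ :+ v :* u′ :* g) :* f :+ (v :* v′) :* (g :* g′)
                      := (u :* f :+ v :* g) :* (u′ :* f :+ v′ :* g′))
                   ≈-refl f g g′ u v u′ v′ ⟩
      (u ⊛ f ⊕ v ⊛ g) ⊛ (u′ ⊛ f ⊕ v′ ⊛ g′)   ≈⟨ ⊛-cong uf+vg≈1 u′f+v′g′≈1 ⟩
      1ₛ ⊛ 1ₛ                                  ≈⟨ ⊛-identityˡ 1ₛ ⟩
      1ₛ                                       ∎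

  Coprime-⊛^ : ∀ {f g} e → IsPolynomial f → IsPolynomial g → Coprime f g → Coprime f (g ⊛^ e)
  Coprime-⊛^ zero f-poly g-poly f⊥g = Coprime-1ₛ
  Coprime-⊛^ (suc e) f-poly g-poly f⊥g =
    Coprime-⊛ʳ f-poly g-poly (IsPolynomial-⊛^ e g-poly) f⊥g (Coprime-⊛^ e f-poly g-poly f⊥g)

  ∣ₚ-⊛-coprime : ∀ {f g h} → f ∣ₚ h → g ∣ₚ h → Coprime f g → f ⊛ g ∣ₚ h
  ∣ₚ-⊛-coprime {f} {g} {h} (a , a-poly , fa≈h) (b , b-poly , gb≈h) (u , v , u-poly , v-poly , uf+vg≈1) =
    u ⊛ b ⊕ v ⊛ a ,
    IsPolynomial-⊕ (IsPolynomial-⊛ u-poly b-poly) (IsPolynomial-⊛ v-poly a-poly) ,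
    quotient
    where
    open SetoidReasoning ≈-setoid
    quotient : f ⊛ g ⊛ (u ⊛ b ⊕ v ⊛ a) ≈ h
    quotient = begin
      f ⊛ g ⊛ (u ⊛ b ⊕ v ⊛ a)           ≈⟨ solve 6 (λ f g u v a b → f :* g :* (u :* b :+ v :* a)
                                                        := u :* f :* (g :* b) :+ v :* g :* (f :* a))
                                                    ≈-refl f g u v a b ⟩
      u ⊛ f ⊛ (g ⊛ b) ⊕ v ⊛ g ⊛ (f ⊛ a) ≈⟨ ⊕-cong (⊛-congˡ (u ⊛ f) gb≈h) (⊛-congˡ (v ⊛ g) fa≈h) ⟩
      u ⊛ f ⊛ h ⊕ v ⊛ g ⊛ h             ≈⟨ ≈-sym (⊛-distribʳ h (u ⊛ f) (v ⊛ g)) ⟩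
      (u ⊛ f ⊕ v ⊛ g) ⊛ h               ≈⟨ ⊛-congʳ h uf+vg≈1 ⟩
      1ₛ ⊛ h                             ≈⟨ ⊛-identityˡ h ⟩
      h                                  ∎

module RangeSum where

  open import Data.Bool using (Bool; true; false; if_then_else_)
  open import Data.Empty using (⊥-elim)
  open import Data.List using (List; []; _∷_; [_]; _++_; _∷ʳ_; map; upTo; applyUpTo; length; filterᵇ)
  open import Data.List.Properties using (map-++; map-∘; map-applyUpTo; upTo-∷ʳ)
  open import Data.List.Relation.Unary.All using (All)
  open import Data.List.Relation.Unary.All.Properties using (applyUpTo⁺₁)
  open import Data.Nat as ℕ using (ℕ; zero; suc; pred; _+_; _*_; _∸_; _≤_; _<_; z≤n; s≤s)
  import Data.Nat.Properties as ℕ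
  open import Algebra.Properties.CommutativeSemigroup ℕ.+-commutativeSemigroup
    using () renaming (interchange to +-interchange)
  open import Data.Nat.DivMod using (_/_; m*n/n≡m)
  open import Data.Nat.ListAction using (sum)
  open import Data.Nat.ListAction.Properties using (sum-++)
  open import Data.Nat.Solver using (module +-*-Solver)
  open import Data.Product using (_×_; _,_; proj₁; proj₂)
  open import Data.Sum using (_⊎_; inj₁; inj₂)
  open import Function using (_∘_)
  open import Level using (Level)
  open import Relation.Binary.PropositionalEquality hiding ([_])
  open import Relation.Nullary using (¬_; Dec; does; yes; no)

  private
    variable
      ℓ ℓ′ : Level
      P : Set ℓ
      Q : Set ℓ′

  𝟙 : Dec P → ℕ
  𝟙 P? = if does P? then 1 else 0

  𝟙-yes : (P? : Dec P) → P → 𝟙 P? ≡ 1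
  𝟙-yes (yes _) _ = refl
  𝟙-yes (no ¬p) p = ⊥-elim (¬p p)

  𝟙-no : (P? : Dec P) → ¬ P → 𝟙 P? ≡ 0
  𝟙-no (yes p) ¬p = ⊥-elim (¬p p)
  𝟙-no (no _) _ = refl

  𝟙≡1⇒ : (P? : Dec P) → 𝟙 P? ≡ 1 → P
  𝟙≡1⇒ (yes p) _ = p

  𝟙-≤1 : (P? : Dec P) → 𝟙 P? ≤ 1
  𝟙-≤1 (yes _) = ℕ.≤-refl
  𝟙-≤1 (no _) = z≤n

  𝟙-mono : (P? : Dec P) (Q? : Dec Q) → (P → Q) → 𝟙 P? ≤ 𝟙 Q?
  𝟙-mono (yes p) Q? P→Q = ℕ.≤-reflexive (sym (𝟙-yes Q? (P→Q p)))
  𝟙-mono (no _) Q? P→Q = z≤n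

  𝟙-cong : (P? : Dec P) (Q? : Dec Q) → (P → Q) → (Q → P) → 𝟙 P? ≡ 𝟙 Q?
  𝟙-cong (yes p) Q? P→Q Q→P = sym (𝟙-yes Q? (P→Q p))
  𝟙-cong (no ¬p) Q? P→Q Q→P = sym (𝟙-no Q? (¬p ∘ Q→P))

  infix 4 _∈[1‥_]
  _∈[1‥_] : ℕ → ℕ → Set
  x ∈[1‥ N ] = 1 ≤ x × x ≤ N

  ∈[1‥]-suc : ∀ {x N} → x ∈[1‥ N ] → x ∈[1‥ suc N ]
  ∈[1‥]-suc (1≤x , x≤N) = 1≤x , ℕ.m≤n⇒m≤1+n x≤N

  top∈[1‥] : ∀ N → suc N ∈[1‥ suc N ]
  top∈[1‥] N = s≤s z≤n , ℕ.≤-refl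

  ∉[1‥0] : ∀ {x} → ¬ x ∈[1‥ 0 ]
  ∉[1‥0] (1≤x , x≤0) = ℕ.<-irrefl refl (ℕ.≤-trans 1≤x x≤0)

  ∈[1‥suc]-split : ∀ {x N} → x ∈[1‥ suc N ] → x ∈[1‥ N ] ⊎ x ≡ suc N
  ∈[1‥suc]-split (1≤x , x≤1+N) with ℕ.m≤n⇒m<n∨m≡n x≤1+N
  ... | inj₁ (s≤s x≤N) = inj₁ (1≤x , x≤N)
  ... | inj₂ x≡1+N = inj₂ x≡1+N

  ∑₁ : ℕ → (ℕ → ℕ) → ℕ
  ∑₁ zero h = 0
  ∑₁ (suc N) h = ∑₁ N h + h (suc N)

  ∑₁-cong : ∀ N {f g} → (∀ x → x ∈[1‥ N ] → f x ≡ g x) → ∑₁ N f ≡ ∑₁ N g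
  ∑₁-cong zero f≡g = refl
  ∑₁-cong (suc N) f≡g = cong₂ _+_ (∑₁-cong N (λ x → f≡g x ∘ ∈[1‥]-suc)) (f≡g (suc N) (top∈[1‥] N))

  ∑₁-zero : ∀ N {f} → (∀ x → x ∈[1‥ N ] → f x ≡ 0) → ∑₁ N f ≡ 0
  ∑₁-zero zero f≡0 = refl
  ∑₁-zero (suc N) f≡0 =
    cong₂ _+_ (∑₁-zero N (λ x → f≡0 x ∘ ∈[1‥]-suc)) (f≡0 (suc N) (top∈[1‥] N))

  ∑₁-mono-≤ : ∀ N {f g} → (∀ x → x ∈[1‥ N ] → f x ≤ g x) → ∑₁ N f ≤ ∑₁ N g
  ∑₁-mono-≤ zero f≤g = z≤n
  ∑₁-mono-≤ (suc N) f≤g = ℕ.+-mono-≤ (∑₁-mono-≤ N (λ x → f≤g x ∘ ∈[1‥]-suc)) (f≤g (suc N) (top∈[1‥] N))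

  ∑₁-distrib-+ : ∀ N f g → ∑₁ N (λ x → f x + g x) ≡ ∑₁ N f + ∑₁ N g
  ∑₁-distrib-+ zero f g = refl
  ∑₁-distrib-+ (suc N) f g = begin
    ∑₁ N (λ x → f x + g x) + (f (suc N) + g (suc N))  ≡⟨ cong (_+ (f (suc N) + g (suc N))) (∑₁-distrib-+ N f g) ⟩
    (∑₁ N f + ∑₁ N g) + (f (suc N) + g (suc N))        ≡⟨ +-interchange (∑₁ N f) (∑₁ N g) (f (suc N)) (g (suc N)) ⟩
    (∑₁ N f + f (suc N)) + (∑₁ N g + g (suc N))        ∎
    where open ≡-Reasoning

  ∑₁-comm : ∀ M N (F : ℕ → ℕ → ℕ) → ∑₁ M (λ x → ∑₁ N (F x)) ≡ ∑₁ N (λ y → ∑₁ M (λ x → F x y))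
  ∑₁-comm zero N F = sym (∑₁-zero N (λ _ _ → refl))
  ∑₁-comm (suc M) N F =
    trans (cong (_+ ∑₁ N (F (suc M))) (∑₁-comm M N F))
          (sym (∑₁-distrib-+ N (λ y → ∑₁ M (λ x → F x y)) (F (suc M))))

  ∑₁-++ : ∀ M N f → ∑₁ (M + N) f ≡ ∑₁ M f + ∑₁ N (λ i → f (M + i))
  ∑₁-++ M zero f = trans (cong (λ L → ∑₁ L f) (ℕ.+-identityʳ M)) (sym (ℕ.+-identityʳ (∑₁ M f)))
  ∑₁-++ M (suc N) f = begin
    ∑₁ (M + suc N) f                                   ≡⟨ cong (λ L → ∑₁ L f) (ℕ.+-suc M N) ⟩
    ∑₁ (M + N) f + f (suc (M + N))                     ≡⟨ cong (_+ f (suc (M + N))) (∑₁-++ M N f) ⟩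
    ∑₁ M f + ∑₁ N (λ i → f (M + i)) + f (suc (M + N)) ≡⟨ ℕ.+-assoc (∑₁ M f) _ _ ⟩
    ∑₁ M f + (∑₁ N (λ i → f (M + i)) + f (suc (M + N))) ≡⟨ cong (λ j → ∑₁ M f + (∑₁ N (λ i → f (M + i)) + f j)) (ℕ.+-suc M N) ⟨
    ∑₁ M f + ∑₁ (suc N) (λ i → f (M + i))              ∎
    where open ≡-Reasoning

  ∑₁-1 : ∀ N → ∑₁ N (λ _ → 1) ≡ N
  ∑₁-1 zero = refl
  ∑₁-1 (suc N) = trans (cong (_+ 1) (∑₁-1 N)) (ℕ.+-comm N 1)

  ∑₁-id : ∀ N → ∑₁ N (λ x → x) ≡ ∑₁ N pred + N
  ∑₁-id N = begin
    ∑₁ N (λ x → x)                  ≡⟨ ∑₁-cong N (λ x x∈ → sym (pred+1 x (proj₁ x∈))) ⟩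
    ∑₁ N (λ x → pred x + 1)         ≡⟨ ∑₁-distrib-+ N pred (λ _ → 1) ⟩
    ∑₁ N pred + ∑₁ N (λ _ → 1)      ≡⟨ cong (∑₁ N pred +_) (∑₁-1 N) ⟩
    ∑₁ N pred + N                   ∎
    where
    open ≡-Reasoning
    pred+1 : ∀ x → 1 ≤ x → pred x + 1 ≡ x
    pred+1 (suc x) _ = ℕ.+-comm x 1

  ∑₁-δ : ∀ N {a} → a ∈[1‥ N ] → ∑₁ N (λ x → 𝟙 (x ℕ.≟ a)) ≡ 1
  ∑₁-δ zero a∈ = ⊥-elim (∉[1‥0] a∈)
  ∑₁-δ (suc N) {a} a∈ with ∈[1‥suc]-split a∈
  ... | inj₁ a∈′ = trans (cong₂ _+_ (∑₁-δ N a∈′) (𝟙-no (suc N ℕ.≟ a) λ { refl → ℕ.<-irrefl refl (s≤s (proj₂ a∈′)) })) refl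
  ... | inj₂ refl = cong₂ _+_ (∑₁-zero N λ x x∈ → 𝟙-no (x ℕ.≟ suc N) λ { refl → ℕ.<-irrefl refl (s≤s (proj₂ x∈)) })
                             (𝟙-yes (suc N ℕ.≟ suc N) refl)

  sum-map-upTo : ∀ h n → sum (map h (upTo n)) ≡ ∑₁ n (h ∘ pred)
  sum-map-upTo h zero = refl
  sum-map-upTo h (suc n) = begin
    sum (map h (upTo (suc n)))            ≡⟨ cong (sum ∘ map h) (upTo-∷ʳ n) ⟨
    sum (map h (upTo n ∷ʳ n))             ≡⟨ cong sum (map-++ h (upTo n) [ n ]) ⟩
    sum (map h (upTo n) ++ [ h n ])       ≡⟨ sum-++ (map h (upTo n)) [ h n ] ⟩
    sum (map h (upTo n)) + (h n + 0)      ≡⟨ cong₂ _+_ (sum-map-upTo h n) (ℕ.+-identityʳ (h n)) ⟩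
    ∑₁ n (h ∘ pred) + h n                 ∎
    where open ≡-Reasoning

  range : ℕ → List ℕ
  range n = applyUpTo suc n

  All-range : ∀ n → All (_∈[1‥ n ]) (range n)
  All-range n = applyUpTo⁺₁ suc n (λ i<n → s≤s z≤n , i<n)

  sum-map-range : ∀ h n → sum (map h (range n)) ≡ ∑₁ n h
  sum-map-range h n = begin
    sum (map h (applyUpTo suc n))     ≡⟨ cong (sum ∘ map h) (map-applyUpTo (λ i → i) suc n) ⟨
    sum (map h (map suc (upTo n)))    ≡⟨ cong sum (map-∘ (upTo n)) ⟨
    sum (map (h ∘ suc) (upTo n))      ≡⟨ sum-map-upTo (h ∘ suc) n ⟩
    ∑₁ n (h ∘ suc ∘ pred)             ≡⟨ ∑₁-cong n (λ { (suc x) _ → refl }) ⟩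
    ∑₁ n h                            ∎
    where open ≡-Reasoning

  length-filterᵇ : ∀ {a} {A : Set a} (p : A → Bool) xs →
                   length (filterᵇ p xs) ≡ sum (map (λ x → if p x then 1 else 0) xs)
  length-filterᵇ p [] = refl
  length-filterᵇ p (x ∷ xs) with p x
  ... | true = cong suc (length-filterᵇ p xs)
  ... | false = length-filterᵇ p xs

  ∑₁-pred*2 : ∀ N → ∑₁ N pred * 2 ≡ N * (N ∸ 1)
  ∑₁-pred*2 zero = refl
  ∑₁-pred*2 (suc N) = begin
    (∑₁ N pred + N) * 2           ≡⟨ ℕ.*-distribʳ-+ 2 (∑₁ N pred) N ⟩
    ∑₁ N pred * 2 + N * 2         ≡⟨ cong (_+ N * 2) (∑₁-pred*2 N) ⟩
    N * (N ∸ 1) + N * 2           ≡⟨ step N ⟩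
    suc N * N                     ∎
    where
    open ≡-Reasoning
    step : ∀ N → N * (N ∸ 1) + N * 2 ≡ suc N * N
    step zero = refl
    step (suc M) = solve 1 (λ M → (con 1 :+ M) :* M :+ (con 1 :+ M) :* con 2 := (con 2 :+ M) :* (con 1 :+ M)) refl M
      where open +-*-Solver

  ∑₁-pred : ∀ N → ∑₁ N pred ≡ N * (N ∸ 1) / 2
  ∑₁-pred N = trans (sym (m*n/n≡m (∑₁ N pred) 2)) (cong (_/ 2) (∑₁-pred*2 N))

module Span where

  open import Algebra.Bundles using (CommutativeRing)
  open import Data.Empty using (⊥-elim)
  open import Data.Fin using (Fin; punchIn) renaming (zero to fzero; suc to fsuc)
  import Data.Fin.Properties as Fin
  open import Data.List using (List; []; _∷_; _++_; length; map; tabulate)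
  open import Data.List.Properties using (length-++)
  open import Data.Nat as ℕ using (ℕ; zero; suc; _≤_; z≤n; s≤s) renaming (_+_ to _+ℕ_)
  import Data.Nat.Properties as ℕ
  open import Data.Product using (∃; _,_; proj₁; proj₂)
  open import Data.Sum using (inj₁; inj₂)
  open import Data.Rational using (ℚ; 0ℚ; 1ℚ; _+_; _*_; -_)
  open import Data.Rational.Properties
  open import Data.Rational.Solver using (module +-*-Solver)
  open import Data.Vec.Functional using (insertAt)
  open import Data.Vec.Functional.Properties using (insertAt-lookup; insertAt-punchIn)
  open import Function using (_∘_)
  open import Relation.Binary.PropositionalEquality
  open import Relation.Nullary using (¬_; Dec; yes; no)
  open import Relation.Nullary.Decidable using (¬?; decidable-stable)

  open import Algebra.Properties.Semiring.Sum (CommutativeRing.semiring +-*-commutativeRing)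
    using (sum; sum-cong-≗; sum-replicate-zero; ∑-distrib-+; *-distribʳ-sum; sum-remove)

  open PowerSeries
  open Polynomial using (≢0∧*≡0⇒≡0)
  open RangeSum using (𝟙; ∑₁; _∈[1‥_]; ∉[1‥0]; ∈[1‥suc]-split)
  open +-*-Solver using (solve; _:=_; _:+_; _:*_; :-_; con)

  InSpan : List PowerSeries → PowerSeries → Set
  InSpan [] g = g ≈ 0ₛ
  InSpan (e ∷ es) g = ∃ λ a → InSpan es (g ⊖ a · e)

  InSpan-resp-≈ : ∀ es {g h} → g ≈ h → InSpan es g → InSpan es h
  InSpan-resp-≈ [] g≈h g≈0 = ≈-trans (≈-sym g≈h) g≈0
  InSpan-resp-≈ (e ∷ es) g≈h (a , rest) = a , InSpan-resp-≈ es (⊕-cong g≈h ≈-refl) rest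

  ⊖0·-identity : ∀ g e → g ⊖ 0ℚ · e ≈ g
  ⊖0·-identity g e k = g-0·e (g k) (e k)
    where
    g-0·e : ∀ x y → x + - (0ℚ * y) ≡ x
    g-0·e = solve 2 (λ x y → x :+ :- (con 0ℚ :* y) := x) refl

  InSpan-0ₛ : ∀ es → InSpan es 0ₛ
  InSpan-0ₛ [] = ≈-refl
  InSpan-0ₛ (e ∷ es) = 0ℚ , InSpan-resp-≈ es (≈-sym (⊖0·-identity 0ₛ e)) (InSpan-0ₛ es)

  InSpan-∷ : ∀ e es {g} → InSpan es g → InSpan (e ∷ es) g
  InSpan-∷ e es {g} g∈es = 0ℚ , InSpan-resp-≈ es (≈-sym (⊖0·-identity g e)) g∈es

  InSpan-++ˡ : ∀ es fs {g} → InSpan es g → InSpan (es ++ fs) g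
  InSpan-++ˡ [] fs g≈0 = InSpan-resp-≈ fs (≈-sym g≈0) (InSpan-0ₛ fs)
  InSpan-++ˡ (e ∷ es) fs (a , rest) = a , InSpan-++ˡ es fs rest

  InSpan-++ʳ : ∀ es fs {g} → InSpan fs g → InSpan (es ++ fs) g
  InSpan-++ʳ [] fs g∈fs = g∈fs
  InSpan-++ʳ (e ∷ es) fs g∈fs = InSpan-∷ e (es ++ fs) (InSpan-++ʳ es fs g∈fs)

  InSpan-· : ∀ es b {g} → InSpan es g → InSpan es (b · g)
  InSpan-· [] b g≈0 k = trans (cong (b *_) (g≈0 k)) (*-zeroʳ b)
  InSpan-· (e ∷ es) b {g} (a , rest) = b * a , InSpan-resp-≈ es (λ k → distrib b (g k) a (e k)) (InSpan-· es b rest)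
    where
    distrib : ∀ b x a y → b * (x + - (a * y)) ≡ b * x + - ((b * a) * y)
    distrib = solve 4 (λ b x a y → b :* (x :+ :- (a :* y)) := b :* x :+ :- ((b :* a) :* y)) refl

  InSpan-⊕ : ∀ es {g h} → InSpan es g → InSpan es h → InSpan es (g ⊕ h)
  InSpan-⊕ [] g≈0 h≈0 k = trans (cong₂ _+_ (g≈0 k) (h≈0 k)) (+-identityˡ 0ℚ)
  InSpan-⊕ (e ∷ es) {g} {h} (a , g-rest) (b , h-rest) =
    a + b , InSpan-resp-≈ es (λ k → regroup (g k) (h k) a b (e k)) (InSpan-⊕ es g-rest h-rest)
    where
    regroup : ∀ x y a b z → (x + - (a * z)) + (y + - (b * z)) ≡ (x + y) + - ((a + b) * z)
    regroup = solve 5 (λ x y a b z → (x :+ :- (a :* z)) :+ (y :+ :- (b :* z))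
                                     := (x :+ y) :+ :- ((a :+ b) :* z)) refl

  LinearlyIndependent : (r : ℕ) → (Fin r → PowerSeries) → Set
  LinearlyIndependent r g =
    (c : Fin r → ℚ) → (∀ k → sum (λ i → c i * g i k) ≡ 0ℚ) → ∀ i → c i ≡ 0ℚ

  private
    -- Steinitz exchange: eliminate the first spanning vector e by a member gₚ whose e-coefficient aₚ is nonzero.
    eliminate : ∀ {r} (g : Fin (suc r) → PowerSeries) (a : Fin (suc r) → ℚ) (p : Fin (suc r)) →
                Fin r → PowerSeries
    eliminate g a p i = a p · g (punchIn p i) ⊖ a (punchIn p i) · g p

    pivotCoefficients : ∀ {r} (a : Fin (suc r) → ℚ) (p : Fin (suc r)) → (Fin r → ℚ) → Fin (suc r) → ℚ
    pivotCoefficients a p c = insertAt (λ i → c i * a p) p (sum (λ i → - c i * a (punchIn p i)))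

    eliminate-combination :
      ∀ {r} (g : Fin (suc r) → PowerSeries) a p (c : Fin r → ℚ) k →
      sum (λ j → pivotCoefficients a p c j * g j k) ≡ sum (λ i → c i * eliminate g a p i k)
    eliminate-combination {r} g a p c k = begin
      sum (λ j → c̃ j * g j k)
        ≡⟨ sum-remove {i = p} (λ j → c̃ j * g j k) ⟩
      c̃ p * g p k + sum (λ i → c̃ (punchIn p i) * g (punchIn p i) k)
        ≡⟨ cong₂ _+_ (cong (_* g p k) (insertAt-lookup _ p _))
                     (sum-cong-≗ (λ i → cong (_* g (punchIn p i) k) (insertAt-punchIn _ p _ i))) ⟩
      sum (λ i → - c i * a (punchIn p i)) * g p k + sum (λ i → c i * a p * g (punchIn p i) k)
        ≡⟨ cong (_+ sum (λ i → c i * a p * g (punchIn p i) k)) (*-distribʳ-sum (g p k) (λ i → - c i * a (punchIn p i))) ⟩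
      sum (λ i → - c i * a (punchIn p i) * g p k) + sum (λ i → c i * a p * g (punchIn p i) k)
        ≡⟨ sym (∑-distrib-+ (λ i → - c i * a (punchIn p i) * g p k) (λ i → c i * a p * g (punchIn p i) k)) ⟩
      sum (λ i → - c i * a (punchIn p i) * g p k + c i * a p * g (punchIn p i) k)
        ≡⟨ sum-cong-≗ (λ i → regroup (c i) (a p) (a (punchIn p i)) (g (punchIn p i) k) (g p k)) ⟩
      sum (λ i → c i * eliminate g a p i k)
        ∎
      where
      open ≡-Reasoning
      c̃ : Fin (suc r) → ℚ
      c̃ = pivotCoefficients a p c
      regroup : ∀ c aₚ aᵢ gᵢ gₚ → - c * aᵢ * gₚ + c * aₚ * gᵢ ≡ c * (aₚ * gᵢ + - (aᵢ * gₚ))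
      regroup = solve 5 (λ c aₚ aᵢ gᵢ gₚ → :- c :* aᵢ :* gₚ :+ c :* aₚ :* gᵢ
                                          := c :* (aₚ :* gᵢ :+ :- (aᵢ :* gₚ))) refl

    eliminate-InSpan : ∀ e es {r} (g : Fin (suc r) → PowerSeries) (spans : ∀ j → InSpan (e ∷ es) (g j)) p i →
                       InSpan es (eliminate g (proj₁ ∘ spans) p i)
    eliminate-InSpan e es {r} g spans p i =
      InSpan-resp-≈ es (λ k → regroup (a p) (g (punchIn p i) k) (a (punchIn p i)) (e k) (g p k))
        (InSpan-⊕ es (InSpan-· es (a p) (proj₂ (spans (punchIn p i))))
                     (InSpan-· es (- a (punchIn p i)) (proj₂ (spans p))))
      where
      a : Fin (suc r) → ℚ
      a = proj₁ ∘ spans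
      regroup : ∀ aₚ gᵢ aᵢ e gₚ → aₚ * (gᵢ + - (aᵢ * e)) + - aᵢ * (gₚ + - (aₚ * e)) ≡ aₚ * gᵢ + - (aᵢ * gₚ)
      regroup = solve 5 (λ aₚ gᵢ aᵢ e gₚ → aₚ :* (gᵢ :+ :- (aᵢ :* e)) :+ :- aᵢ :* (gₚ :+ :- (aₚ :* e))
                                          := aₚ :* gᵢ :+ :- (aᵢ :* gₚ)) refl

    eliminate-independent : ∀ {r} (g : Fin (suc r) → PowerSeries) a p → a p ≢ 0ℚ →
                            LinearlyIndependent (suc r) g → LinearlyIndependent r (eliminate g a p)
    eliminate-independent g a p aₚ≢0 indep c Σcw≡0 i = ≢0∧*≡0⇒≡0 aₚ≢0 (begin
      a p * c i                        ≡⟨ *-comm (a p) (c i) ⟩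
      c i * a p                        ≡⟨ insertAt-punchIn _ p _ i ⟨
      pivotCoefficients a p c (punchIn p i)
                                       ≡⟨ indep (pivotCoefficients a p c)
                                            (λ k → trans (eliminate-combination g a p c k) (Σcw≡0 k)) (punchIn p i) ⟩
      0ℚ                               ∎)
      where open ≡-Reasoning

  linearlyIndependent⇒≤length : ∀ es {r} (g : Fin r → PowerSeries) →
                                (∀ i → InSpan es (g i)) → LinearlyIndependent r g → r ≤ length es
  linearlyIndependent⇒≤length es {zero} g spans indep = z≤n
  linearlyIndependent⇒≤length [] {suc r} g g≈0 indep = ⊥-elim (1≢0 (indep (λ _ → 1ℚ) Σg≡0 fzero))
    where
    Σg≡0 : ∀ k → sum (λ i → 1ℚ * g i k) ≡ 0ℚ
    Σg≡0 k = trans (sum-cong-≗ (λ i → trans (cong (1ℚ *_) (g≈0 i k)) (*-zeroʳ 1ℚ))) (sum-replicate-zero (suc r))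
  linearlyIndependent⇒≤length (e ∷ es) {suc r} g spans indep
    with Fin.any? (λ i → ¬? (proj₁ (spans i) ≟ 0ℚ))
  ... | yes (p , aₚ≢0) = s≤s (linearlyIndependent⇒≤length es (eliminate g (proj₁ ∘ spans) p)
                                (eliminate-InSpan e es g spans p)
                                (eliminate-independent g (proj₁ ∘ spans) p aₚ≢0 indep))
  ... | no ∄aᵢ≢0 = ℕ.m≤n⇒m≤1+n (linearlyIndependent⇒≤length es g spansWithout-e indep)
    where
    spansWithout-e : ∀ i → InSpan es (g i)
    spansWithout-e i with proj₁ (spans i) ≟ 0ℚ
    ... | yes aᵢ≡0 = InSpan-resp-≈ es
            (λ k → trans (cong (λ a → g i k + - (a * e k)) aᵢ≡0) (⊖0·-identity (g i) e k)) (proj₂ (spans i))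
    ... | no aᵢ≢0 = ⊥-elim (∄aᵢ≢0 (i , aᵢ≢0))

  ¬¬-∀-Fin : ∀ {r p} {P : Fin r → Set p} → (∀ i → ¬ ¬ P i) → ¬ ¬ (∀ i → P i)
  ¬¬-∀-Fin {zero} ¬¬P ¬∀P = ¬∀P (λ ())
  ¬¬-∀-Fin {suc r} {P = P} ¬¬P ¬∀P =
    ¬¬P fzero (λ P0 → ¬¬-∀-Fin (¬¬P ∘ fsuc) (λ Psuc → ¬∀P λ { fzero → P0 ; (fsuc i) → Psuc i }))

  ¬¬InSpan∧linearlyIndependent⇒≤length : ∀ es {r} (g : Fin r → PowerSeries) →
    (∀ i → ¬ ¬ InSpan es (g i)) → LinearlyIndependent r g → r ≤ length es
  ¬¬InSpan∧linearlyIndependent⇒≤length es {r} g ¬¬spans indep =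
    decidable-stable (r ℕ.≤? length es)
      (λ r≰ → ¬¬-∀-Fin ¬¬spans (λ spans → r≰ (linearlyIndependent⇒≤length es g spans indep)))

  shiftsOf : PowerSeries → ℕ → List PowerSeries
  shiftsOf y zero = []
  shiftsOf y (suc c) = X^ c ⊛ y ∷ shiftsOf y c

  length-shiftsOf : ∀ y c → length (shiftsOf y c) ≡ c
  length-shiftsOf y zero = refl
  length-shiftsOf y (suc c) = cong suc (length-shiftsOf y c)

  InSpan-shiftsOf : ∀ y c f → (∀ k → c ≤ k → f k ≡ 0ℚ) → InSpan (shiftsOf y c) (f ⊛ y)
  InSpan-shiftsOf y zero f f≡0 = ≈-trans (⊛-congʳ y (λ k → f≡0 k z≤n)) (⊛-zeroˡ y)
  InSpan-shiftsOf y (suc c) f f≡0 =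
    f c , InSpan-resp-≈ (shiftsOf y c) (⊛-distrib-lead) (InSpan-shiftsOf y c (f ⊖ f c · X^ c) below)
    where
    ⊛-distrib-lead : (f ⊖ f c · X^ c) ⊛ y ≈ f ⊛ y ⊖ f c · (X^ c ⊛ y)
    ⊛-distrib-lead = ≈-trans (⊛-distribʳ-⊖ y f (f c · X^ c)) (⊕-congˡ (f ⊛ y) (⊝-cong (·-⊛ (f c) (X^ c) y)))
    below : ∀ k → c ≤ k → (f ⊖ f c · X^ c) k ≡ 0ℚ
    below k c≤k with ℕ.m≤n⇒m<n∨m≡n c≤k
    ... | inj₂ refl = trans (cong (λ x → f c + - (f c * x)) (X^-diag c))
                            (trans (cong (λ x → f c + - x) (*-identityʳ (f c))) (+-inverseʳ (f c)))
    ... | inj₁ c<k = trans (cong₂ (λ a x → a + - (f c * x)) (f≡0 k c<k) (X^-off-diag c k (ℕ.<⇒≢ c<k)))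
                           (trans (cong (λ x → 0ℚ + - x) (*-zeroʳ (f c))) refl)

  InSpan-map-⊛ : ∀ h es {g} → InSpan es g → InSpan (map (h ⊛_) es) (h ⊛ g)
  InSpan-map-⊛ h [] g≈0 = ≈-trans (⊛-congˡ h g≈0) (⊛-zeroʳ h)
  InSpan-map-⊛ h (e ∷ es) {g} (a , rest) =
    a , InSpan-resp-≈ (map (h ⊛_) es)
          (≈-trans (⊛-distribˡ-⊖ h g (a · e)) (⊕-congˡ (h ⊛ g) (⊝-cong (⊛-· a h e))))
          (InSpan-map-⊛ h es rest)

  InSpan-tabulate : ∀ {r} (h : Fin r → PowerSeries) (a : Fin r → ℚ) {g} →
                    (∀ k → g k ≡ sum (λ i → a i * h i k)) → InSpan (tabulate h) g
  InSpan-tabulate {zero} h a g≡ = g≡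
  InSpan-tabulate {suc r} h a {g} g≡ =
    a fzero , InSpan-tabulate (h ∘ fsuc) (a ∘ fsuc) (λ k →
      trans (cong (_+ - (a fzero * h fzero k)) (g≡ k))
            (cancel (a fzero * h fzero k) (sum (λ i → a (fsuc i) * h (fsuc i) k))))
    where
    cancel : ∀ x y → (x + y) + - x ≡ y
    cancel = solve 2 (λ x y → (x :+ y) :+ :- x := y) refl

  concat₁ : ℕ → (ℕ → List PowerSeries) → List PowerSeries
  concat₁ zero B = []
  concat₁ (suc N) B = concat₁ N B ++ B (suc N)

  length-concat₁ : ∀ N B → length (concat₁ N B) ≡ ∑₁ N (length ∘ B)
  length-concat₁ zero B = refl
  length-concat₁ (suc N) B = trans (length-++ (concat₁ N B)) (cong (_+ℕ length (B (suc N))) (length-concat₁ N B))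

  InSpan-concat₁ : ∀ N B {j g} → j ∈[1‥ N ] → InSpan (B j) g → InSpan (concat₁ N B) g
  InSpan-concat₁ zero B j∈ _ = ⊥-elim (∉[1‥0] j∈)
  InSpan-concat₁ (suc N) B j∈ g∈Bj with ∈[1‥suc]-split j∈
  ... | inj₁ j∈′ = InSpan-++ˡ (concat₁ N B) (B (suc N)) (InSpan-concat₁ N B j∈′ g∈Bj)
  ... | inj₂ refl = InSpan-++ʳ (concat₁ N B) (B (suc N)) g∈Bj

  optionally : ∀ {p} {P : Set p} → Dec P → List PowerSeries → List PowerSeries
  optionally (yes _) es = es
  optionally (no _) es = []

  length-optionally : ∀ {p} {P : Set p} (P? : Dec P) es → length (optionally P? es) ≡ 𝟙 P? ℕ.* length es
  length-optionally (yes _) es = sym (ℕ.+-identityʳ (length es))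
  length-optionally (no _) es = refl

  InSpan-optionally : ∀ {p} {P : Set p} (P? : Dec P) es {g} → P → InSpan es g → InSpan (optionally P? es) g
  InSpan-optionally (yes _) es p g∈es = g∈es
  InSpan-optionally (no ¬p) es p g∈es = ⊥-elim (¬p p)

module NatToRational where

  open import Data.Integer as ℤ using () renaming (+_ to +ℤ_)
  import Data.Integer.Properties as ℤ
  open import Data.Empty using (⊥-elim)
  open import Data.Nat as ℕ using (ℕ; zero; suc)
  open import Data.Nat.Coprimality using (1-coprimeTo) renaming (sym to coprime-sym)
  open import Data.Rational using (0ℚ; 1ℚ; _+_; _*_; mkℚ; toℚᵘ)
  open import Data.Rational.Properties
  import Data.Rational.Unnormalised as ℚᵘ
  import Data.Rational.Unnormalised.Properties as ℚᵘ
  open import Relation.Binary.PropositionalEquality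

  open import Defs using (toℚ)

  toℚ≡mkℚ : ∀ n → toℚ n ≡ mkℚ (+ℤ n) 0 (coprime-sym (1-coprimeTo n))
  toℚ≡mkℚ n = normalize-coprime (coprime-sym (1-coprimeTo n))

  toℚ-suc : ∀ n → toℚ (suc n) ≡ 1ℚ + toℚ n
  toℚ-suc n = toℚᵘ-injective (begin
    toℚᵘ (toℚ (suc n))             ≡⟨ cong toℚᵘ (toℚ≡mkℚ (suc n)) ⟩
    ℚᵘ.mkℚᵘ (+ℤ (suc n)) 0      ≈⟨ unnormalised ⟩
    toℚᵘ 1ℚ ℚᵘ.+ toℚᵘ (toℚ n)      ≈⟨ toℚᵘ-homo-+ 1ℚ (toℚ n) ⟨
    toℚᵘ (1ℚ + toℚ n)              ∎)
    where
    open ℚᵘ.≃-Reasoning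
    unnormalised : ℚᵘ.mkℚᵘ (+ℤ (suc n)) 0 ℚᵘ.≃ toℚᵘ 1ℚ ℚᵘ.+ toℚᵘ (toℚ n)
    unnormalised rewrite toℚ≡mkℚ n =
      ℚᵘ.*≡* (cong (ℤ._* +ℤ 1) (sym (cong (ℤ._+_ (+ℤ 1)) (ℤ.*-identityʳ (+ℤ n)))))

  toℚ-+ : ∀ a b → toℚ (a ℕ.+ b) ≡ toℚ a + toℚ b
  toℚ-+ zero b = sym (+-identityˡ (toℚ b))
  toℚ-+ (suc a) b = begin
    toℚ (suc (a ℕ.+ b))       ≡⟨ toℚ-suc (a ℕ.+ b) ⟩
    1ℚ + toℚ (a ℕ.+ b)        ≡⟨ cong (1ℚ +_) (toℚ-+ a b) ⟩
    1ℚ + (toℚ a + toℚ b)      ≡⟨ +-assoc 1ℚ (toℚ a) (toℚ b) ⟨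
    1ℚ + toℚ a + toℚ b        ≡⟨ cong (_+ toℚ b) (toℚ-suc a) ⟨
    toℚ (suc a) + toℚ b       ∎
    where open ≡-Reasoning

  toℚ-* : ∀ a b → toℚ (a ℕ.* b) ≡ toℚ a * toℚ b
  toℚ-* zero b = sym (*-zeroˡ (toℚ b))
  toℚ-* (suc a) b = begin
    toℚ (b ℕ.+ a ℕ.* b)       ≡⟨ toℚ-+ b (a ℕ.* b) ⟩
    toℚ b + toℚ (a ℕ.* b)     ≡⟨ cong (toℚ b +_) (toℚ-* a b) ⟩
    toℚ b + toℚ a * toℚ b     ≡⟨ cong (_+ toℚ a * toℚ b) (*-identityˡ (toℚ b)) ⟨
    1ℚ * toℚ b + toℚ a * toℚ b ≡⟨ *-distribʳ-+ (toℚ b) 1ℚ (toℚ a) ⟨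
    (1ℚ + toℚ a) * toℚ b      ≡⟨ cong (_* toℚ b) (toℚ-suc a) ⟨
    toℚ (suc a) * toℚ b       ∎
    where open ≡-Reasoning

  toℚ-≢0 : ∀ n → n ≢ 0 → toℚ n ≢ 0ℚ
  toℚ-≢0 zero n≢0 = ⊥-elim (n≢0 refl)
  toℚ-≢0 (suc n) _ eq with trans (sym (toℚ≡mkℚ (suc n))) eq
  ... | ()

module Binomial where

  open import Data.Nat as ℕ using (ℕ; zero; suc; _≤_; _<_)
  import Data.Nat.Properties as ℕ
  open import Data.Nat.Divisibility using (_∣_; divides)
  open import Data.Nat.GCD using (gcd; gcd-GCD; gcd-comm; module Bézout)
  open import Data.Product using (∃₂; _×_; _,_)
  open import Data.Rational using (0ℚ; 1ℚ; _+_; -_)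
  open import Data.Rational.Properties using (+-identityʳ)
  open import Relation.Binary.PropositionalEquality
  import Relation.Binary.Reasoning.Setoid as SetoidReasoning

  open import Defs using (toℚ)
  open NatToRational using (toℚ-suc)
  open PowerSeries
  open Polynomial
  open Solver using (solve; _:=_; _:+_; _:*_; _:-_; :-_; con)

  1-X^_ : ℕ → PowerSeries
  1-X^ k = 1ₛ ⊖ X^ k

  1-X^-cong : ∀ {a b} → a ≡ b → 1-X^ a ≈ 1-X^ b
  1-X^-cong refl = ≈-refl

  IsPolynomial-1-X^ : ∀ k → IsPolynomial (1-X^ k)
  IsPolynomial-1-X^ k = IsPolynomial-⊕ IsPolynomial-1ₛ (IsPolynomial-⊝ (IsPolynomial-X^ k))

  HasDegree-1-X^ : ∀ d → 1 ≤ d → HasDegree (1-X^ d) d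
  HasDegree-1-X^ (suc d) _ = above , leading
    where
    above : Deg≤ (1-X^ suc d) (suc d)
    above (suc k) d<k = trans (cong (λ c → 0ℚ + - c) (X^-off-diag (suc d) (suc k) (ℕ.<⇒≢ d<k))) refl
    leading : (1-X^ suc d) (suc d) ≢ 0ℚ
    leading eq with trans (sym (cong (λ c → 0ℚ + - c) (X^-diag (suc d)))) eq
    ... | ()

  1-X^-coeff₀ : ∀ d → 1 ≤ d → (1-X^ d) 0 ≡ 1ℚ
  1-X^-coeff₀ (suc d) _ = refl

  geometricSum : ℕ → ℕ → PowerSeries
  geometricSum a zero = 0ₛ
  geometricSum a (suc k) = geometricSum a k ⊕ X^ (a ℕ.* k)

  IsPolynomial-geometricSum : ∀ a k → IsPolynomial (geometricSum a k)
  IsPolynomial-geometricSum a zero = IsPolynomial-0ₛ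
  IsPolynomial-geometricSum a (suc k) =
    IsPolynomial-⊕ (IsPolynomial-geometricSum a k) (IsPolynomial-X^ (a ℕ.* k))

  1-X^-⊛-geometricSum : ∀ a k → 1-X^ a ⊛ geometricSum a k ≈ 1-X^ (a ℕ.* k)
  1-X^-⊛-geometricSum a zero = ≈-trans (⊛-zeroʳ (1-X^ a))
    (≈-trans (≈-sym (⊝-inverseʳ 1ₛ)) (⊕-congˡ 1ₛ (⊝-cong (≈-reflexive (cong X^_ (sym (ℕ.*-zeroʳ a)))))))
  1-X^-⊛-geometricSum a (suc k) = begin
    1-X^ a ⊛ (geometricSum a k ⊕ X^ (a ℕ.* k))
      ≈⟨ ⊛-distribˡ (1-X^ a) (geometricSum a k) (X^ (a ℕ.* k)) ⟩
    1-X^ a ⊛ geometricSum a k ⊕ 1-X^ a ⊛ X^ (a ℕ.* k)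
      ≈⟨ ⊕-congʳ (1-X^ a ⊛ X^ (a ℕ.* k)) (1-X^-⊛-geometricSum a k) ⟩
    1-X^ (a ℕ.* k) ⊕ 1-X^ a ⊛ X^ (a ℕ.* k)
      ≈⟨ solve 2 (λ A M → (con 1ℚ :- M) :+ (con 1ℚ :- A) :* M := con 1ℚ :- A :* M) ≈-refl (X^ a) (X^ (a ℕ.* k)) ⟩
    1ₛ ⊖ X^ a ⊛ X^ (a ℕ.* k)
      ≈⟨ ⊕-congˡ 1ₛ (⊝-cong (≈-trans (X^-+ a (a ℕ.* k)) (≈-reflexive (cong X^_ (sym (ℕ.*-suc a k)))))) ⟩
    1-X^ (a ℕ.* suc k) ∎
    where open SetoidReasoning ≈-setoid

  1-X^-∣ₚ : ∀ {a b} → a ∣ b → 1-X^ a ∣ₚ 1-X^ b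
  1-X^-∣ₚ {a} (divides k refl) =
    geometricSum a k , IsPolynomial-geometricSum a k ,
    ≈-trans (1-X^-⊛-geometricSum a k) (1-X^-cong (ℕ.*-comm a k))

  -- Each X^(a i) - 1 is a multiple of 1 - X^a.
  1-X^-∣ₚ-geometricSum⊖const : ∀ a k → 1-X^ a ∣ₚ geometricSum a k ⊖ const (toℚ k)
  1-X^-∣ₚ-geometricSum⊖const a zero =
    0ₛ , IsPolynomial-0ₛ , ≈-trans (⊛-zeroʳ (1-X^ a)) (≈-sym (≈-trans (⊕-identityˡ (⊝ const 0ℚ)) zero≈))
    where
    zero≈ : ⊝ const 0ℚ ≈ 0ₛ
    zero≈ zero = refl
    zero≈ (suc k) = refl
  1-X^-∣ₚ-geometricSum⊖const a (suc k) with 1-X^-∣ₚ-geometricSum⊖const a k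
  ... | h , h-poly , [1-X^a]h≈G-k =
    h ⊖ geometricSum a k ,
    IsPolynomial-⊕ h-poly (IsPolynomial-⊝ (IsPolynomial-geometricSum a k)) ,
    (begin
      1-X^ a ⊛ (h ⊖ geometricSum a k)
        ≈⟨ solve 3 (λ F h G → F :* (h :- G) := F :* h :- F :* G) ≈-refl (1-X^ a) h (geometricSum a k) ⟩
      1-X^ a ⊛ h ⊖ 1-X^ a ⊛ geometricSum a k
        ≈⟨ ⊕-cong [1-X^a]h≈G-k (⊝-cong (1-X^-⊛-geometricSum a k)) ⟩
      geometricSum a k ⊖ const (toℚ k) ⊖ 1-X^ (a ℕ.* k)
        ≈⟨ solve 3 (λ G K M → G :- K :- (con 1ℚ :- M) := G :+ M :- (con 1ℚ :+ K))
                 ≈-refl (geometricSum a k) (const (toℚ k)) (X^ (a ℕ.* k)) ⟩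
      geometricSum a (suc k) ⊖ (const 1ℚ ⊕ const (toℚ k))
        ≈⟨ ⊕-congˡ (geometricSum a (suc k)) (⊝-cong (λ { zero → sym (toℚ-suc k) ; (suc _) → +-identityʳ 0ℚ })) ⟩
      geometricSum a (suc k) ⊖ const (toℚ (suc k)) ∎)
    where open SetoidReasoning ≈-setoid

  private
    bézout-oriented : ∀ m n x y → gcd m n ℕ.+ y ℕ.* n ≡ x ℕ.* m →
      geometricSum m x ⊛ 1-X^ m ⊕ ⊝ (X^ gcd m n ⊛ geometricSum n y) ⊛ 1-X^ n ≈ 1-X^ gcd m n
    bézout-oriented m n x y eq = begin
      geometricSum m x ⊛ 1-X^ m ⊕ ⊝ (X^ d ⊛ geometricSum n y) ⊛ 1-X^ n
        ≈⟨ solve 5 (λ Gm Fm D Gn Fn → Gm :* Fm :+ (:- (D :* Gn)) :* Fn := Fm :* Gm :- D :* (Fn :* Gn))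
                 ≈-refl (geometricSum m x) (1-X^ m) (X^ d) (geometricSum n y) (1-X^ n) ⟩
      1-X^ m ⊛ geometricSum m x ⊖ X^ d ⊛ (1-X^ n ⊛ geometricSum n y)
        ≈⟨ ⊕-cong (1-X^-⊛-geometricSum m x) (⊝-cong (⊛-congˡ (X^ d) (1-X^-⊛-geometricSum n y))) ⟩
      1-X^ (m ℕ.* x) ⊖ X^ d ⊛ 1-X^ (n ℕ.* y)
        ≈⟨ solve 3 (λ A D B → (con 1ℚ :- A) :- D :* (con 1ℚ :- B) := (con 1ℚ :- D) :+ (D :* B :- A))
                 ≈-refl (X^ (m ℕ.* x)) (X^ d) (X^ (n ℕ.* y)) ⟩
      1-X^ d ⊕ (X^ d ⊛ X^ (n ℕ.* y) ⊖ X^ (m ℕ.* x))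
        ≈⟨ ⊕-congˡ (1-X^ d) (≈-trans (⊕-congʳ (⊝ X^ (m ℕ.* x))
                                              (≈-trans (X^-+ d (n ℕ.* y)) (≈-reflexive (cong X^_ exponents))))
                                     (⊝-inverseʳ (X^ (m ℕ.* x)))) ⟩
      1-X^ d ⊕ 0ₛ
        ≈⟨ ⊕-identityʳ (1-X^ d) ⟩
      1-X^ d ∎
      where
      open SetoidReasoning ≈-setoid
      d : ℕ
      d = gcd m n
      exponents : d ℕ.+ n ℕ.* y ≡ m ℕ.* x
      exponents = trans (cong (d ℕ.+_) (ℕ.*-comm n y)) (trans eq (ℕ.*-comm x m))

  bézout : ∀ m n → ∃₂ λ u v → IsPolynomial u × IsPolynomial v × u ⊛ 1-X^ m ⊕ v ⊛ 1-X^ n ≈ 1-X^ gcd m n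
  bézout m n with Bézout.identity (gcd-GCD m n)
  ... | Bézout.Identity.+- x y eq =
    geometricSum m x , ⊝ (X^ gcd m n ⊛ geometricSum n y) ,
    IsPolynomial-geometricSum m x ,
    IsPolynomial-⊝ (IsPolynomial-⊛ (IsPolynomial-X^ (gcd m n)) (IsPolynomial-geometricSum n y)) ,
    bézout-oriented m n x y eq
  ... | Bézout.Identity.-+ x y eq =
    ⊝ (X^ gcd n m ⊛ geometricSum m x) , geometricSum n y ,
    IsPolynomial-⊝ (IsPolynomial-⊛ (IsPolynomial-X^ (gcd n m)) (IsPolynomial-geometricSum m x)) ,
    IsPolynomial-geometricSum n y ,
    ≈-trans (⊕-comm (⊝ (X^ gcd n m ⊛ geometricSum m x) ⊛ 1-X^ m) (geometricSum n y ⊛ 1-X^ n))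
            (≈-trans (bézout-oriented n m y x (trans (cong (ℕ._+ x ℕ.* m) (gcd-comm n m)) eq))
                     (1-X^-cong (gcd-comm n m)))

module RangeProduct where

  open import Data.Empty using (⊥-elim)
  open import Data.Nat as ℕ using (ℕ; zero; suc; _+_; _*_; _∸_; _≤_; _<_; s≤s; _≟_)
  import Data.Nat.Properties as ℕ
  open import Data.Product using (_,_; proj₂)
  open import Data.Rational using (1ℚ) renaming (_*_ to _*ℚ_)
  open import Data.Rational.Properties using (*-identityˡ)
  open import Data.Sum using (inj₁; inj₂)
  open import Function using (_∘_)
  open import Relation.Binary.PropositionalEquality
  import Relation.Binary.Reasoning.Setoid as SetoidReasoning
  open import Relation.Nullary using (yes; no)

  open PowerSeries
  open Polynomial
  open RangeSum
  open Solver using (solve; _:=_; _:*_)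

  ∏^ : (ℕ → PowerSeries) → ℕ → (ℕ → ℕ) → PowerSeries
  ∏^ Φ zero e = 1ₛ
  ∏^ Φ (suc N) e = ∏^ Φ N e ⊛ Φ (suc N) ⊛^ e (suc N)

  ∏^-+ : ∀ Φ N e e′ → ∏^ Φ N (λ x → e x + e′ x) ≈ ∏^ Φ N e ⊛ ∏^ Φ N e′
  ∏^-+ Φ zero e e′ = ≈-sym (⊛-identityˡ 1ₛ)
  ∏^-+ Φ (suc N) e e′ = begin
    ∏^ Φ N (λ x → e x + e′ x) ⊛ Φ (suc N) ⊛^ (e (suc N) + e′ (suc N))
      ≈⟨ ⊛-cong (∏^-+ Φ N e e′) (⊛^-+ (Φ (suc N)) (e (suc N)) (e′ (suc N))) ⟩
    (∏^ Φ N e ⊛ ∏^ Φ N e′) ⊛ (Φ (suc N) ⊛^ e (suc N) ⊛ Φ (suc N) ⊛^ e′ (suc N))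
      ≈⟨ solve 4 (λ a b c d → (a :* b) :* (c :* d) := (a :* c) :* (b :* d)) ≈-refl
               (∏^ Φ N e) (∏^ Φ N e′) (Φ (suc N) ⊛^ e (suc N)) (Φ (suc N) ⊛^ e′ (suc N)) ⟩
    ∏^ Φ (suc N) e ⊛ ∏^ Φ (suc N) e′ ∎
    where open SetoidReasoning ≈-setoid

  ∏^-cong : ∀ {Φ Φ′} N {e e′} → (∀ x → x ∈[1‥ N ] → Φ x ≈ Φ′ x) → (∀ x → x ∈[1‥ N ] → e x ≡ e′ x) →
            ∏^ Φ N e ≈ ∏^ Φ′ N e′
  ∏^-cong zero Φ≈Φ′ e≡e′ = ≈-refl
  ∏^-cong {Φ} {Φ′} (suc N) {e} {e′} Φ≈Φ′ e≡e′ =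
    ⊛-cong (∏^-cong N (λ x → Φ≈Φ′ x ∘ ∈[1‥]-suc) (λ x → e≡e′ x ∘ ∈[1‥]-suc))
           (≈-trans (⊛^-congˡ (e (suc N)) (Φ≈Φ′ (suc N) (top∈[1‥] N)))
                    (≈-reflexive (cong (Φ′ (suc N) ⊛^_) (e≡e′ (suc N) (top∈[1‥] N)))))

  ∏^-cong-exp : ∀ Φ N {e e′} → (∀ x → x ∈[1‥ N ] → e x ≡ e′ x) → ∏^ Φ N e ≈ ∏^ Φ N e′
  ∏^-cong-exp Φ N = ∏^-cong N (λ _ _ → ≈-refl)

  ∏^-0 : ∀ Φ N e → (∀ x → x ∈[1‥ N ] → e x ≡ 0) → ∏^ Φ N e ≈ 1ₛ
  ∏^-0 Φ zero e e≡0 = ≈-refl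
  ∏^-0 Φ (suc N) e e≡0 rewrite e≡0 (suc N) (top∈[1‥] N) =
    ≈-trans (⊛-identityʳ (∏^ Φ N e)) (∏^-0 Φ N e (λ x → e≡0 x ∘ ∈[1‥]-suc))

  ∏^-extend : ∀ Φ N M e → N ≤ M → (∀ x → N < x → x ≤ M → e x ≡ 0) → ∏^ Φ M e ≈ ∏^ Φ N e
  ∏^-extend Φ N zero e N≤0 e≡0 with ℕ.n≤0⇒n≡0 N≤0
  ... | refl = ≈-refl
  ∏^-extend Φ N (suc M) e N≤1+M e≡0 with ℕ.m≤n⇒m<n∨m≡n N≤1+M
  ... | inj₂ refl = ≈-refl
  ... | inj₁ (s≤s N≤M) rewrite e≡0 (suc M) (s≤s N≤M) ℕ.≤-refl =
    ≈-trans (⊛-identityʳ (∏^ Φ M e)) (∏^-extend Φ N M e N≤M (λ x N<x x≤M → e≡0 x N<x (ℕ.m≤n⇒m≤1+n x≤M)))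

  ∏^-δ : ∀ Φ N y → y ∈[1‥ N ] → ∏^ Φ N (λ x → 𝟙 (x ≟ y)) ≈ Φ y
  ∏^-δ Φ zero y y∈ = ⊥-elim (∉[1‥0] y∈)
  ∏^-δ Φ (suc N) y y∈ with ∈[1‥suc]-split y∈
  ... | inj₂ refl rewrite 𝟙-yes (suc N ≟ suc N) refl =
    ≈-trans (⊛-congʳ (Φ (suc N) ⊛^ 1)
               (∏^-0 Φ N _ (λ x x∈ → 𝟙-no (x ≟ suc N) (λ { refl → ℕ.<-irrefl refl (s≤s (proj₂ x∈)) }))))
            (≈-trans (⊛-identityˡ (Φ (suc N) ⊛^ 1)) (⊛-identityʳ (Φ (suc N))))
  ... | inj₁ y∈′ rewrite 𝟙-no (suc N ≟ y) (λ { refl → ℕ.<-irrefl refl (s≤s (proj₂ y∈′)) }) =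
    ≈-trans (⊛-identityʳ (∏^ Φ N (λ x → 𝟙 (x ≟ y)))) (∏^-δ Φ N y y∈′)

  IsPolynomial-∏^ : ∀ Φ N e → (∀ x → x ∈[1‥ N ] → IsPolynomial (Φ x)) → IsPolynomial (∏^ Φ N e)
  IsPolynomial-∏^ Φ zero e Φ-poly = IsPolynomial-1ₛ
  IsPolynomial-∏^ Φ (suc N) e Φ-poly =
    IsPolynomial-⊛ (IsPolynomial-∏^ Φ N e (λ x → Φ-poly x ∘ ∈[1‥]-suc))
                   (IsPolynomial-⊛^ (e (suc N)) (Φ-poly (suc N) (top∈[1‥] N)))

  HasDegree-∏^ : ∀ Φ N e (deg : ℕ → ℕ) → (∀ x → x ∈[1‥ N ] → HasDegree (Φ x) (deg x)) →
                 HasDegree (∏^ Φ N e) (∑₁ N (λ x → e x * deg x))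
  HasDegree-∏^ Φ zero e deg Φ∈deg = HasDegree-1ₛ
  HasDegree-∏^ Φ (suc N) e deg Φ∈deg =
    HasDegree-⊛ (HasDegree-∏^ Φ N e deg (λ x → Φ∈deg x ∘ ∈[1‥]-suc))
                (HasDegree-⊛^ (e (suc N)) (Φ∈deg (suc N) (top∈[1‥] N)))

  ⊛^-coeff₀ : ∀ f e → f 0 ≡ 1ℚ → (f ⊛^ e) 0 ≡ 1ℚ
  ⊛^-coeff₀ f zero f₀≡1 = refl
  ⊛^-coeff₀ f (suc e) f₀≡1 = trans (cong₂ _*ℚ_ f₀≡1 (⊛^-coeff₀ f e f₀≡1)) (*-identityˡ 1ℚ)

  ∏^-coeff₀ : ∀ Φ N e → (∀ x → x ∈[1‥ N ] → Φ x 0 ≡ 1ℚ) → ∏^ Φ N e 0 ≡ 1ℚ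
  ∏^-coeff₀ Φ zero e Φ₀≡1 = refl
  ∏^-coeff₀ Φ (suc N) e Φ₀≡1 =
    trans (cong₂ _*ℚ_ (∏^-coeff₀ Φ N e (λ x → Φ₀≡1 x ∘ ∈[1‥]-suc)) (⊛^-coeff₀ (Φ (suc N)) (e (suc N)) (Φ₀≡1 (suc N) (top∈[1‥] N))))
          (*-identityˡ 1ℚ)

  Coprime-∏^ : ∀ {f} Φ N e → IsPolynomial f → (∀ x → x ∈[1‥ N ] → IsPolynomial (Φ x)) →
               (∀ x → x ∈[1‥ N ] → Coprime f (Φ x)) → Coprime f (∏^ Φ N e)
  Coprime-∏^ Φ zero e f-poly Φ-poly f⊥Φ = Coprime-1ₛ
  Coprime-∏^ Φ (suc N) e f-poly Φ-poly f⊥Φ =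
    Coprime-⊛ʳ f-poly (IsPolynomial-∏^ Φ N e (λ x → Φ-poly x ∘ ∈[1‥]-suc))
               (IsPolynomial-⊛^ (e (suc N)) (Φ-poly (suc N) (top∈[1‥] N)))
               (Coprime-∏^ Φ N e f-poly (λ x → Φ-poly x ∘ ∈[1‥]-suc) (λ x → f⊥Φ x ∘ ∈[1‥]-suc))
               (Coprime-⊛^ (e (suc N)) f-poly (Φ-poly (suc N) (top∈[1‥] N)) (f⊥Φ (suc N) (top∈[1‥] N)))

  ∣ₚ-∏^ : ∀ Φ N e y → (∀ x → x ∈[1‥ N ] → IsPolynomial (Φ x)) → y ∈[1‥ N ] → 1 ≤ e y → Φ y ∣ₚ ∏^ Φ N e
  ∣ₚ-∏^ Φ N e y Φ-poly y∈ 1≤ey =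
    ∏^ Φ N rest , IsPolynomial-∏^ Φ N rest Φ-poly , (begin
      Φ y ⊛ ∏^ Φ N rest                                  ≈⟨ ⊛-congʳ (∏^ Φ N rest) (∏^-δ Φ N y y∈) ⟨
      ∏^ Φ N (λ x → 𝟙 (x ≟ y)) ⊛ ∏^ Φ N rest             ≈⟨ ∏^-+ Φ N (λ x → 𝟙 (x ≟ y)) rest ⟨
      ∏^ Φ N (λ x → 𝟙 (x ≟ y) + rest x)                  ≈⟨ ∏^-cong-exp Φ N (λ x _ → split x) ⟩
      ∏^ Φ N e                                           ∎)
    where
    open SetoidReasoning ≈-setoid
    rest : ℕ → ℕ
    rest x = e x ∸ 𝟙 (x ≟ y)
    split : ∀ x → 𝟙 (x ≟ y) + rest x ≡ e x
    split x with x ≟ y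
    ... | yes refl = trans (cong (λ b → b + (e x ∸ b)) (𝟙-yes (x ≟ x) refl)) (ℕ.m+[n∸m]≡n 1≤ey)
    ... | no x≢y = cong (λ b → b + (e x ∸ b)) (𝟙-no (x ≟ y) x≢y)

module Totient where

  open import Data.List using (map; upTo)
  open import Data.List.Properties using (map-applyUpTo)
  open import Data.Nat as ℕ using (ℕ; zero; suc; pred; _+_; _*_; _≤_; _<_; z≤n; s≤s; _≟_)
  import Data.Nat.Properties as ℕ
  open import Data.Nat.Divisibility using (_∣_; _∣?_; divides; ∣⇒≤; ∣m+n∣m⇒∣n; m∣m*n; ∣-refl; ∣1⇒≡1)
  open import Data.Nat.GCD using (gcd; gcd-greatest; gcd[m,n]∣m; gcd[m,n]∣n; gcd[m,n]≢0; c*gcd[m,n]≡gcd[cm,cn])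
  open import Data.Nat.DivMod using (_/_; _%_; m%n<n; m≡m%n+[m/n]*n)
  open import Data.Nat.ListAction using (sum)
  open import Data.Product using (_,_; proj₁; proj₂)
  open import Data.Sum using (inj₂)
  open import Function using (_∘_)
  open import Relation.Binary.PropositionalEquality
  open import Relation.Nullary using (¬_; yes; no)

  open import Defs using (φ)
  open RangeSum

  𝟙[_∣_] : ℕ → ℕ → ℕ
  𝟙[ x ∣ k ] = 𝟙 (x ∣? k)

  φ≡∑₁ : ∀ j → φ j ≡ ∑₁ j (λ k → 𝟙 (gcd k j ≟ 1))
  φ≡∑₁ j = begin
    φ j                            ≡⟨ length-filterᵇ (λ k → gcd k j ℕ.≡ᵇ 1) (map suc (upTo j)) ⟩
    sum (map F (map suc (upTo j))) ≡⟨ cong (sum ∘ map F) (map-applyUpTo (λ i → i) suc j) ⟩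
    sum (map F (range j))          ≡⟨ sum-map-range F j ⟩
    ∑₁ j F                         ∎
    where
    open ≡-Reasoning
    F : ℕ → ℕ
    F k = 𝟙 (gcd k j ≟ 1)

  φ≤pred : ∀ j → 2 ≤ j → φ j ≤ pred j
  φ≤pred j@(suc i@(suc _)) (s≤s (s≤s z≤n)) = begin
    φ j                                                  ≡⟨ φ≡∑₁ j ⟩
    ∑₁ i (λ k → 𝟙 (gcd k j ≟ 1)) + 𝟙 (gcd j j ≟ 1)       ≡⟨ cong (∑₁ i (λ k → 𝟙 (gcd k j ≟ 1)) +_) (𝟙-no (gcd j j ≟ 1) gcd[j,j]≢1) ⟩
    ∑₁ i (λ k → 𝟙 (gcd k j ≟ 1)) + 0                     ≤⟨ ℕ.+-monoˡ-≤ 0 (∑₁-mono-≤ i (λ k _ → 𝟙-≤1 (gcd k j ≟ 1))) ⟩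
    ∑₁ i (λ _ → 1) + 0                                   ≡⟨ cong (_+ 0) (∑₁-1 i) ⟩
    i + 0                                                ≡⟨ ℕ.+-identityʳ i ⟩
    i                                                    ∎
    where
    open ℕ.≤-Reasoning
    gcd[j,j]≢1 : gcd j j ≢ 1
    gcd[j,j]≢1 eq with ∣1⇒≡1 (subst (j ∣_) eq (gcd-greatest ∣-refl ∣-refl))
    ... | ()

  ∑₁-offset-indivisible : ∀ g q r (F : ℕ → ℕ) → r < g → (∀ k → ¬ g ∣ k → F k ≡ 0) → ∑₁ r (λ i → F (g * q + i)) ≡ 0
  ∑₁-offset-indivisible g q r F r<g F≡0 = ∑₁-zero r {λ i → F (g * q + i)} (λ i i∈ → F≡0 (g * q + i) (λ g∣ →
    ℕ.<-irrefl refl (ℕ.<-≤-trans r<g (ℕ.≤-trans (∣⇒≤ {{ℕ.>-nonZero (proj₁ i∈)}} (∣m+n∣m⇒∣n g∣ (m∣m*n q))) (proj₂ i∈)))))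

  ∑₁-multiples : ∀ g x (F : ℕ → ℕ) → 1 ≤ g → (∀ k → ¬ g ∣ k → F k ≡ 0) → ∑₁ (g * x) F ≡ ∑₁ x (λ k → F (g * k))
  ∑₁-multiples g zero F 1≤g F≡0 rewrite ℕ.*-zeroʳ g = refl
  ∑₁-multiples g@(suc g-1) (suc x) F 1≤g F≡0 = begin
    ∑₁ (g * suc x) F                                          ≡⟨ cong (λ L → ∑₁ L F) g[1+x] ⟩
    ∑₁ (g * x + g) F                                          ≡⟨ ∑₁-++ (g * x) g F ⟩
    ∑₁ (g * x) F + ∑₁ g (λ i → F (g * x + i))                 ≡⟨ cong₂ _+_ (∑₁-multiples g x F 1≤g F≡0) lastBlock ⟩
    ∑₁ x (λ k → F (g * k)) + F (g * x + g)                    ≡⟨ cong (λ j → ∑₁ x (λ k → F (g * k)) + F j) g[1+x] ⟨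
    ∑₁ (suc x) (λ k → F (g * k))                              ∎
    where
    open ≡-Reasoning
    g[1+x] : g * suc x ≡ g * x + g
    g[1+x] = trans (ℕ.*-suc g x) (ℕ.+-comm g (g * x))
    lastBlock : ∑₁ g (λ i → F (g * x + i)) ≡ F (g * x + g)
    lastBlock = cong (_+ F (g * x + g)) (∑₁-offset-indivisible g x g-1 F ℕ.≤-refl F≡0)

  ∑₁-𝟙∣ : ∀ n j .{{_ : ℕ.NonZero j}} → ∑₁ n (λ k → 𝟙[ j ∣ k ]) ≡ n / j
  ∑₁-𝟙∣ n j@(suc _) = begin
    ∑₁ n F                                    ≡⟨ cong (λ L → ∑₁ L F) n≡jq+r ⟩
    ∑₁ (j * q + r) F                          ≡⟨ ∑₁-++ (j * q) r F ⟩
    ∑₁ (j * q) F + ∑₁ r (λ i → F (j * q + i)) ≡⟨ cong₂ _+_ (∑₁-multiples j q F (s≤s z≤n) (λ k → 𝟙-no (j ∣? k)))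
                                                           (∑₁-offset-indivisible j q r F (m%n<n n j) (λ k → 𝟙-no (j ∣? k))) ⟩
    ∑₁ q (λ k → F (j * k)) + 0                ≡⟨ ℕ.+-identityʳ _ ⟩
    ∑₁ q (λ k → F (j * k))                    ≡⟨ ∑₁-cong q (λ k _ → 𝟙-yes (j ∣? j * k) (m∣m*n k)) ⟩
    ∑₁ q (λ _ → 1)                            ≡⟨ ∑₁-1 q ⟩
    q                                         ∎
    where
    open ≡-Reasoning
    F : ℕ → ℕ
    F k = 𝟙[ j ∣ k ]
    q r : ℕ
    q = n / j
    r = n % j
    n≡jq+r : n ≡ j * q + r
    n≡jq+r = trans (m≡m%n+[m/n]*n n j) (trans (ℕ.+-comm r (q * j)) (cong (_+ r) (ℕ.*-comm q j)))

  private
    coprimeCount : ∀ q x → 1 ≤ q → ∑₁ (q * x) (λ k → 𝟙 (gcd k (q * x) ≟ q)) ≡ φ x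
    coprimeCount q@(suc _) x _ = begin
      ∑₁ (q * x) (λ k → 𝟙 (gcd k (q * x) ≟ q))    ≡⟨ ∑₁-multiples q x _ (s≤s z≤n) gcd≢q ⟩
      ∑₁ x (λ k → 𝟙 (gcd (q * k) (q * x) ≟ q))    ≡⟨ ∑₁-cong x (λ k _ → gcd-scaled k) ⟩
      ∑₁ x (λ k → 𝟙 (gcd k x ≟ 1))                ≡⟨ φ≡∑₁ x ⟨
      φ x                                          ∎
      where
      open ≡-Reasoning
      gcd≢q : ∀ k → ¬ q ∣ k → 𝟙 (gcd k (q * x) ≟ q) ≡ 0
      gcd≢q k q∤k = 𝟙-no (gcd k (q * x) ≟ q) (λ eq → q∤k (subst (_∣ k) eq (gcd[m,n]∣m k (q * x))))
      gcd-scaled : ∀ k → 𝟙 (gcd (q * k) (q * x) ≟ q) ≡ 𝟙 (gcd k x ≟ 1)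
      gcd-scaled k rewrite sym (c*gcd[m,n]≡gcd[cm,cn] q k x) =
        𝟙-cong (q * gcd k x ≟ q) (gcd k x ≟ 1)
               (λ eq → ℕ.*-cancelˡ-≡ (gcd k x) 1 q (trans eq (sym (ℕ.*-identityʳ q))))
               (λ eq → trans (cong (q *_) eq) (ℕ.*-identityʳ q))

    countByQuotient : ∀ d x → 1 ≤ d → 1 ≤ x → ∑₁ d (λ k → 𝟙 (x * gcd k d ≟ d)) ≡ 𝟙[ x ∣ d ] * φ x
    countByQuotient d x 1≤d 1≤x with x ∣? d
    ... | no x∤d = ∑₁-zero d (λ k _ → 𝟙-no (x * gcd k d ≟ d)
                     (λ eq → x∤d (divides (gcd k d) (trans (sym eq) (ℕ.*-comm x (gcd k d))))))
    ... | yes (divides q d≡qx) = begin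
      ∑₁ d (λ k → 𝟙 (x * gcd k d ≟ d))   ≡⟨ ∑₁-cong d (λ k _ → cancel-x (gcd k d)) ⟩
      ∑₁ d (λ k → 𝟙 (gcd k d ≟ q))       ≡⟨ cong (λ D → ∑₁ D (λ k → 𝟙 (gcd k D ≟ q))) d≡qx ⟩
      ∑₁ (q * x) (λ k → 𝟙 (gcd k (q * x) ≟ q)) ≡⟨ coprimeCount q x 1≤q ⟩
      φ x                                 ≡⟨ ℕ.+-identityʳ (φ x) ⟨
      1 * φ x                             ∎
      where
      open ≡-Reasoning
      1≤q : 1 ≤ q
      1≤q = ℕ.n≢0⇒n>0 (λ q≡0 → ℕ.<-irrefl (sym (trans d≡qx (cong (_* x) q≡0))) 1≤d)
      cancel-x : ∀ a → 𝟙 (x * a ≟ d) ≡ 𝟙 (a ≟ q)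
      cancel-x a = 𝟙-cong (x * a ≟ d) (a ≟ q)
        (λ eq → ℕ.*-cancelˡ-≡ a q x {{ℕ.>-nonZero 1≤x}} (trans eq (trans d≡qx (ℕ.*-comm q x))))
        (λ eq → trans (cong (x *_) eq) (trans (ℕ.*-comm x q) (sym d≡qx)))

    uniqueCofactor : ∀ d k → 1 ≤ d → ∑₁ d (λ x → 𝟙 (x * gcd k d ≟ d)) ≡ 1
    uniqueCofactor d k 1≤d with gcd[m,n]∣n k d
    ... | divides m d≡mg = trans (∑₁-cong d (λ x _ → cancel-g x)) (∑₁-δ d (1≤m , m≤d))
      where
      g : ℕ
      g = gcd k d
      1≤g : 1 ≤ g
      1≤g = ℕ.n≢0⇒n>0 (gcd[m,n]≢0 k d (inj₂ (λ d≡0 → ℕ.<-irrefl (sym d≡0) 1≤d)))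
      1≤m : 1 ≤ m
      1≤m = ℕ.n≢0⇒n>0 (λ m≡0 → ℕ.<-irrefl (sym (trans d≡mg (cong (_* g) m≡0))) 1≤d)
      m≤d : m ≤ d
      m≤d = ∣⇒≤ {{ℕ.>-nonZero 1≤d}} (divides g (trans d≡mg (ℕ.*-comm m g)))
      cancel-g : ∀ x → 𝟙 (x * g ≟ d) ≡ 𝟙 (x ≟ m)
      cancel-g x = 𝟙-cong (x * g ≟ d) (x ≟ m)
        (λ eq → ℕ.*-cancelʳ-≡ x m g {{ℕ.>-nonZero 1≤g}} (trans eq d≡mg))
        (λ eq → trans (cong (_* g) eq) (sym d≡mg))

  -- Count the pairs (x, k) ∈ [1, d]² with x · gcd(k, d) = d in two ways.
  ∑₁-divisors-φ : ∀ d → 1 ≤ d → ∑₁ d (λ x → 𝟙[ x ∣ d ] * φ x) ≡ d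
  ∑₁-divisors-φ d 1≤d = begin
    ∑₁ d (λ x → 𝟙[ x ∣ d ] * φ x)                        ≡⟨ ∑₁-cong d (λ x x∈ → countByQuotient d x 1≤d (proj₁ x∈)) ⟨
    ∑₁ d (λ x → ∑₁ d (λ k → 𝟙 (x * gcd k d ≟ d)))       ≡⟨ ∑₁-comm d d (λ x k → 𝟙 (x * gcd k d ≟ d)) ⟩
    ∑₁ d (λ k → ∑₁ d (λ x → 𝟙 (x * gcd k d ≟ d)))       ≡⟨ ∑₁-cong d (λ k _ → uniqueCofactor d k 1≤d) ⟩
    ∑₁ d (λ _ → 1)                                      ≡⟨ ∑₁-1 d ⟩
    d                                                   ∎
    where open ≡-Reasoning

module Cyclotomic where

  open import Data.Empty using (⊥-elim)
  open import Data.Nat as ℕ using (ℕ; zero; suc; _+_; _*_; _∸_; _≤_; _<_; z≤n; s≤s; _≟_; _≤?_)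
  import Data.Nat.Properties as ℕ
  open import Data.Nat.Divisibility using (_∣_; _∣?_; divides; ∣-trans; ∣-refl; ∣-antisym; ∣⇒≤)
  open import Data.Nat.GCD using (gcd; gcd[m,n]∣m; gcd[m,n]∣n; gcd[m,n]≢0)
  open import Data.Product using (∃; _,_; proj₁; proj₂)
  open import Data.Rational as ℚ using (ℚ; 0ℚ; 1ℚ)
  open import Data.Rational.Properties using (*-identityˡ; 1≢0)
  open import Data.Sum using (inj₁; inj₂)
  open import Function using (_∘_)
  open import Relation.Binary.PropositionalEquality
  import Relation.Binary.Reasoning.Setoid as SetoidReasoning
  open import Relation.Nullary using (¬_; Dec; yes; no)

  open import Defs using (φ; toℚ)
  open NatToRational using (toℚ-≢0)
  open PowerSeries
  open Polynomial
  open Binomial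
  open RangeSum
  open RangeProduct
  open Totient

  -- The cyclotomic polynomials Φ 1, …, Φ N, normalised by their constant term so that
  -- 1 - X^k = ∏_{x ∣ k} Φ x (thus Φ 1 = 1 - X).
  record IsCyclotomicFamily (Φ : ℕ → PowerSeries) (N : ℕ) : Set where
    field
      degree : ∀ x → x ∈[1‥ N ] → HasDegree (Φ x) (φ x)
      coeff₀ : ∀ x → x ∈[1‥ N ] → Φ x 0 ≡ 1ℚ
      factorisation : ∀ k → k ∈[1‥ N ] → ∏^ Φ k (λ x → 𝟙[ x ∣ k ]) ≈ 1-X^ k

    isPolynomial : ∀ x → x ∈[1‥ N ] → IsPolynomial (Φ x)
    isPolynomial x x∈ = φ x , proj₁ (degree x x∈)

    factorisation-∏^N : ∀ k → k ∈[1‥ N ] → ∏^ Φ N (λ x → 𝟙[ x ∣ k ]) ≈ 1-X^ k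
    factorisation-∏^N k k∈ = ≈-trans
      (∏^-extend Φ k N _ (proj₂ k∈) (λ x k<x _ → 𝟙-no (x ∣? k)
        (λ x∣k → ℕ.<-irrefl refl (ℕ.<-≤-trans k<x (∣⇒≤ {{ℕ.>-nonZero (proj₁ k∈)}} x∣k)))))
      (factorisation k k∈)

    ∣ₚ1-X^ : ∀ {y k} → y ∈[1‥ N ] → y ∣ k → Φ y ∣ₚ 1-X^ k
    ∣ₚ1-X^ {y} {k} y∈ y∣k = ∣ₚ-trans Φy∣1-X^y (1-X^-∣ₚ y∣k)
      where
      y∈[1‥y] : y ∈[1‥ y ]
      y∈[1‥y] = proj₁ y∈ , ℕ.≤-refl
      Φy∣1-X^y : Φ y ∣ₚ 1-X^ y
      Φy∣1-X^y = ∣ₚ-respʳ (factorisation y y∈)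
        (∣ₚ-∏^ Φ y _ y (λ x x∈ → isPolynomial x (proj₁ x∈ , ℕ.≤-trans (proj₂ x∈) (proj₂ y∈))) y∈[1‥y]
               (ℕ.≤-reflexive (sym (𝟙-yes (y ∣? y) ∣-refl))))

    ∣ₚ-quotient : ∀ {x g m w} → x ∈[1‥ N ] → g ∈[1‥ N ] → m ∈[1‥ N ] → g ∣ m → x ∣ m → ¬ x ∣ g →
                  1-X^ g ⊛ w ≈ 1-X^ m → Φ x ∣ₚ w
    ∣ₚ-quotient {x} {g} {m} {w} x∈ g∈ m∈ g∣m x∣m x∤g [1-X^g]w≈1-X^m =
      ∣ₚ-respʳ (≈-sym w≈rest) (∣ₚ-∏^ Φ N rest x isPolynomial x∈ (ℕ.≤-reflexive (sym rest[x]≡1)))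
      where
      open SetoidReasoning ≈-setoid
      rest : ℕ → ℕ
      rest z = 𝟙[ z ∣ m ] ∸ 𝟙[ z ∣ g ]
      rest[x]≡1 : rest x ≡ 1
      rest[x]≡1 = cong₂ _∸_ (𝟙-yes (x ∣? m) x∣m) (𝟙-no (x ∣? g) x∤g)
      split : ∀ z → 𝟙[ z ∣ m ] ≡ 𝟙[ z ∣ g ] + rest z
      split z = sym (ℕ.m+[n∸m]≡n (𝟙-mono (z ∣? g) (z ∣? m) (λ z∣g → ∣-trans z∣g g∣m)))
      w≈rest : w ≈ ∏^ Φ N rest
      w≈rest = ⊛-cancelˡ (1-X^ g) (λ eq → 1≢0 (trans (sym (1-X^-coeff₀ g (proj₁ g∈))) eq)) (begin
        1-X^ g ⊛ w                                          ≈⟨ [1-X^g]w≈1-X^m ⟩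
        1-X^ m                                              ≈⟨ factorisation-∏^N m m∈ ⟨
        ∏^ Φ N (λ z → 𝟙[ z ∣ m ])                           ≈⟨ ∏^-cong-exp Φ N (λ z _ → split z) ⟩
        ∏^ Φ N (λ z → 𝟙[ z ∣ g ] + rest z)                  ≈⟨ ∏^-+ Φ N (λ z → 𝟙[ z ∣ g ]) rest ⟩
        ∏^ Φ N (λ z → 𝟙[ z ∣ g ]) ⊛ ∏^ Φ N rest             ≈⟨ ⊛-congʳ (∏^ Φ N rest) (factorisation-∏^N g g∈) ⟩
        1-X^ g ⊛ ∏^ Φ N rest                                ∎)

    -- G = (1 - X^x) / (1 - X^y) is a multiple of Φ x, and G - k is a multiple of 1 - X^y, hence of Φ y.
    coprime-of-divisor : ∀ {x y} → x ∈[1‥ N ] → y ∈[1‥ N ] → y ∣ x → x ≢ y → Coprime (Φ x) (Φ y)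
    coprime-of-divisor {x} {y} x∈ y∈ (divides k x≡ky) x≢y =
      Coprime-via-multiples (toℚ k) k≢0 Φx∣G (∣ₚ1-X^ y∈ ∣-refl) IsPolynomial-1ₛ (IsPolynomial-⊝ h-poly) (begin
        1ₛ ⊛ G ⊕ ⊝ h ⊛ 1-X^ y          ≈⟨ solve 3 (λ G h F → con 1ℚ :* G :+ (:- h) :* F := G :- F :* h) ≈-refl G h (1-X^ y) ⟩
        G ⊖ 1-X^ y ⊛ h                 ≈⟨ ⊕-congˡ G (⊝-cong [1-X^y]h≈G-k) ⟩
        G ⊖ (G ⊖ const (toℚ k))        ≈⟨ solve 2 (λ G K → G :- (G :- K) := K) ≈-refl G (const (toℚ k)) ⟩
        const (toℚ k)                  ∎)
      where
      open SetoidReasoning ≈-setoid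
      open Solver using (solve; _:=_; _:+_; _:*_; _:-_; :-_; con)
      G : PowerSeries
      G = geometricSum y k
      y∣x : y ∣ x
      y∣x = divides k x≡ky
      Φx∣G : Φ x ∣ₚ G
      Φx∣G = ∣ₚ-quotient x∈ y∈ x∈ y∣x ∣-refl (λ x∣y → x≢y (∣-antisym x∣y y∣x))
               (≈-trans (1-X^-⊛-geometricSum y k) (1-X^-cong (trans (ℕ.*-comm y k) (sym x≡ky))))
      quotient : 1-X^ y ∣ₚ G ⊖ const (toℚ k)
      quotient = 1-X^-∣ₚ-geometricSum⊖const y k
      h : PowerSeries
      h = proj₁ quotient
      h-poly : IsPolynomial h
      h-poly = proj₁ (proj₂ quotient)
      [1-X^y]h≈G-k : 1-X^ y ⊛ h ≈ G ⊖ const (toℚ k)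
      [1-X^y]h≈G-k = proj₂ (proj₂ quotient)
      k≢0 : toℚ k ≢ 0ℚ
      k≢0 = toℚ-≢0 k (λ k≡0 → ℕ.<-irrefl (sym (trans x≡ky (cong (_* y) k≡0))) (proj₁ x∈))

    -- Divide the Bézout identity for 1 - X^x and 1 - X^y by 1 - X^gcd(x, y).
    coprime-of-gcd : ∀ {x y} → x ∈[1‥ N ] → y ∈[1‥ N ] → x ≢ gcd x y → y ≢ gcd x y → Coprime (Φ x) (Φ y)
    coprime-of-gcd {x} {y} x∈ y∈ x≢g y≢g with gcd[m,n]∣m x y | gcd[m,n]∣n x y | bézout x y
    ... | g∣x@(divides a x≡ag) | g∣y@(divides b y≡bg) | u , v , u-poly , v-poly , bézout-identity =
      Coprime-via-multiples 1ℚ 1≢0 (Φ∣quotient a x∈ x≡ag x≢g) (Φ∣quotient b y∈ y≡bg y≢g) u-poly v-poly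
        (⊛-cancelˡ (1-X^ g) (λ eq → 1≢0 (trans (sym (1-X^-coeff₀ g 1≤g)) eq)) (begin
          1-X^ g ⊛ (u ⊛ geometricSum g a ⊕ v ⊛ geometricSum g b)
            ≈⟨ solve 5 (λ F u Wx v Wy → F :* (u :* Wx :+ v :* Wy) := u :* (F :* Wx) :+ v :* (F :* Wy))
                     ≈-refl (1-X^ g) u (geometricSum g a) v (geometricSum g b) ⟩
          u ⊛ (1-X^ g ⊛ geometricSum g a) ⊕ v ⊛ (1-X^ g ⊛ geometricSum g b)
            ≈⟨ ⊕-cong (⊛-congˡ u (quotient-identity a x≡ag)) (⊛-congˡ v (quotient-identity b y≡bg)) ⟩
          u ⊛ 1-X^ x ⊕ v ⊛ 1-X^ y   ≈⟨ bézout-identity ⟩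
          1-X^ g                    ≈⟨ ⊛-identityʳ (1-X^ g) ⟨
          1-X^ g ⊛ 1ₛ               ∎))
      where
      open SetoidReasoning ≈-setoid
      open Solver using (solve; _:=_; _:+_; _:*_)
      g : ℕ
      g = gcd x y
      1≤g : 1 ≤ g
      1≤g = ℕ.n≢0⇒n>0 (gcd[m,n]≢0 x y (inj₁ (λ x≡0 → ℕ.<-irrefl (sym x≡0) (proj₁ x∈))))
      g∈ : g ∈[1‥ N ]
      g∈ = 1≤g , ℕ.≤-trans (∣⇒≤ {{ℕ.>-nonZero (proj₁ x∈)}} g∣x) (proj₂ x∈)
      quotient-identity : ∀ {m} c → m ≡ c * g → 1-X^ g ⊛ geometricSum g c ≈ 1-X^ m
      quotient-identity c m≡cg = ≈-trans (1-X^-⊛-geometricSum g c) (1-X^-cong (trans (ℕ.*-comm g c) (sym m≡cg)))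
      Φ∣quotient : ∀ {m} c → m ∈[1‥ N ] → m ≡ c * g → m ≢ g → Φ m ∣ₚ geometricSum g c
      Φ∣quotient {m} c m∈ m≡cg m≢g =
        ∣ₚ-quotient m∈ g∈ m∈ g∣m ∣-refl (λ m∣g → m≢g (∣-antisym m∣g g∣m)) (quotient-identity c m≡cg)
        where
        g∣m : g ∣ m
        g∣m = divides c m≡cg

    coprime : ∀ {x y} → x ∈[1‥ N ] → y ∈[1‥ N ] → x ≢ y → Coprime (Φ x) (Φ y)
    coprime {x} {y} x∈ y∈ x≢y with x ≟ gcd x y | y ≟ gcd x y
    ... | yes x≡g | _ = Coprime-sym (coprime-of-divisor y∈ x∈ (subst (_∣ y) (sym x≡g) (gcd[m,n]∣n x y)) (x≢y ∘ sym))
    ... | no _ | yes y≡g = coprime-of-divisor x∈ y∈ (subst (_∣ x) (sym y≡g) (gcd[m,n]∣m x y)) x≢y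
    ... | no x≢g | no y≢g = coprime-of-gcd x∈ y∈ x≢g y≢g

    ∏^-∣ₚ1-X^ : ∀ m t → t ≤ N → ∏^ Φ t (λ x → 𝟙[ x ∣ m ]) ∣ₚ 1-X^ m
    ∏^-∣ₚ1-X^ m zero _ = 1ₛ∣ₚ (IsPolynomial-1-X^ m)
    ∏^-∣ₚ1-X^ m (suc t) 1+t≤N = lastFactor (suc t ∣? m)
      where
      P : PowerSeries
      P = ∏^ Φ t (λ x → 𝟙[ x ∣ m ])
      P∣1-X^m : P ∣ₚ 1-X^ m
      P∣1-X^m = ∏^-∣ₚ1-X^ m t (ℕ.<⇒≤ 1+t≤N)
      1+t∈ : suc t ∈[1‥ N ]
      1+t∈ = s≤s z≤n , 1+t≤N
      below : ∀ {x} → x ∈[1‥ t ] → x ∈[1‥ N ]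
      below (1≤x , x≤t) = 1≤x , ℕ.≤-trans x≤t (ℕ.<⇒≤ 1+t≤N)
      P⊛Φ^ : ∀ {e} → e ≡ 𝟙[ suc t ∣ m ] → P ⊛ Φ (suc t) ⊛^ 𝟙[ suc t ∣ m ] ≈ P ⊛ Φ (suc t) ⊛^ e
      P⊛Φ^ e≡ = ⊛-congˡ P (≈-reflexive (cong (Φ (suc t) ⊛^_) (sym e≡)))
      lastFactor : Dec (suc t ∣ m) → ∏^ Φ (suc t) (λ x → 𝟙[ x ∣ m ]) ∣ₚ 1-X^ m
      lastFactor (no 1+t∤m) =
        ∣ₚ-respˡ (≈-sym (≈-trans (P⊛Φ^ (sym (𝟙-no (suc t ∣? m) 1+t∤m))) (⊛-identityʳ P))) P∣1-X^m
      lastFactor (yes 1+t∣m) =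
        ∣ₚ-respˡ (≈-sym (≈-trans (P⊛Φ^ (sym (𝟙-yes (suc t ∣? m) 1+t∣m))) (⊛-congˡ P (⊛-identityʳ (Φ (suc t))))))
          (∣ₚ-⊛-coprime P∣1-X^m (∣ₚ1-X^ 1+t∈ 1+t∣m)
            (Coprime-sym (Coprime-∏^ Φ t _ (isPolynomial (suc t) 1+t∈) (λ x → isPolynomial x ∘ below)
                            (λ x x∈ → coprime 1+t∈ (below x∈) (λ eq → ℕ.<-irrefl (sym eq) (s≤s (proj₂ x∈)))))))

  extendFamily : (ℕ → PowerSeries) → ℕ → PowerSeries → ℕ → PowerSeries
  extendFamily Φ N Ψ x with x ≤? N
  ... | yes _ = Φ x
  ... | no _ = Ψ

  extendFamily-old : ∀ Φ N Ψ {x} → x ≤ N → extendFamily Φ N Ψ x ≡ Φ x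
  extendFamily-old Φ N Ψ {x} x≤N with x ≤? N
  ... | yes _ = refl
  ... | no x≰N = ⊥-elim (x≰N x≤N)

  extendFamily-new : ∀ Φ N Ψ → extendFamily Φ N Ψ (suc N) ≡ Ψ
  extendFamily-new Φ N Ψ with suc N ≤? N
  ... | yes 1+N≤N = ⊥-elim (ℕ.<-irrefl refl 1+N≤N)
  ... | no _ = refl

  -- The next cyclotomic polynomial Ψ is the exact quotient of 1 - X^(N+1) by the earlier factors,
  -- and Gauss's identity ∑_{d ∣ n} φ(d) = n pins its degree down to φ(N+1).
  module Extension {Φ N} (family : IsCyclotomicFamily Φ N) where

    open IsCyclotomicFamily family

    private
      d : ℕ
      d = suc N
      P : PowerSeries
      P = ∏^ Φ N (λ x → 𝟙[ x ∣ d ])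
      division : P ∣ₚ 1-X^ d
      division = ∏^-∣ₚ1-X^ d N ℕ.≤-refl

    Ψ : PowerSeries
    Ψ = proj₁ division

    P⊛Ψ≈1-X^ : P ⊛ Ψ ≈ 1-X^ d
    P⊛Ψ≈1-X^ = proj₂ (proj₂ division)

    Ψ-coeff₀ : Ψ 0 ≡ 1ℚ
    Ψ-coeff₀ = begin
      Ψ 0         ≡⟨ *-identityˡ (Ψ 0) ⟨
      1ℚ ℚ.* Ψ 0  ≡⟨ cong (ℚ._* Ψ 0) (∏^-coeff₀ Φ N _ coeff₀) ⟨
      (P ⊛ Ψ) 0   ≡⟨ P⊛Ψ≈1-X^ 0 ⟩
      1ℚ          ∎
      where open ≡-Reasoning

    Ψ-degree : HasDegree Ψ (φ d)
    Ψ-degree = subst (HasDegree Ψ) (ℕ.+-cancelˡ-≡ S _ _ (trans S+t≡d (sym S+φ≡d))) (proj₂ Ψ∈t)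
      where
      Ψ∈t : ∃ (HasDegree Ψ)
      Ψ∈t = nonzero⇒HasDegree (proj₁ (proj₁ (proj₂ division))) (proj₂ (proj₁ (proj₂ division))) {0}
              (λ Ψ₀≡0 → 1≢0 (trans (sym Ψ-coeff₀) Ψ₀≡0))
      S : ℕ
      S = ∑₁ N (λ x → 𝟙[ x ∣ d ] * φ x)
      S+t≡d : S + proj₁ Ψ∈t ≡ d
      S+t≡d = HasDegree-unique
        (HasDegree-resp-≈ P⊛Ψ≈1-X^ (HasDegree-⊛ (HasDegree-∏^ Φ N _ φ degree) (proj₂ Ψ∈t)))
        (HasDegree-1-X^ d (s≤s z≤n))
      S+φ≡d : S + φ d ≡ d
      S+φ≡d = trans (cong (S +_) (sym (trans (cong (_* φ d) (𝟙-yes (d ∣? d) ∣-refl)) (ℕ.+-identityʳ (φ d)))))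
                    (∑₁-divisors-φ d (s≤s z≤n))

    private
      Φ′ : ℕ → PowerSeries
      Φ′ = extendFamily Φ N Ψ
      old : ∀ {x} → x ≤ N → Φ′ x ≈ Φ x
      old x≤N = ≈-reflexive (extendFamily-old Φ N Ψ x≤N)
      new : Φ′ d ≈ Ψ
      new = ≈-reflexive (extendFamily-new Φ N Ψ)

    extended : IsCyclotomicFamily Φ′ d
    extended = record { degree = degree′ ; coeff₀ = coeff₀′ ; factorisation = factorisation′ }
      where
      degree′ : ∀ x → x ∈[1‥ d ] → HasDegree (Φ′ x) (φ x)
      degree′ x x∈ with ∈[1‥suc]-split x∈
      ... | inj₁ x∈′ = HasDegree-resp-≈ (≈-sym (old (proj₂ x∈′))) (degree x x∈′)
      ... | inj₂ refl = HasDegree-resp-≈ (≈-sym new) Ψ-degree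
      coeff₀′ : ∀ x → x ∈[1‥ d ] → Φ′ x 0 ≡ 1ℚ
      coeff₀′ x x∈ with ∈[1‥suc]-split x∈
      ... | inj₁ x∈′ = trans (old (proj₂ x∈′) 0) (coeff₀ x x∈′)
      ... | inj₂ refl = trans (new 0) Ψ-coeff₀
      factorisation′ : ∀ k → k ∈[1‥ d ] → ∏^ Φ′ k (λ x → 𝟙[ x ∣ k ]) ≈ 1-X^ k
      factorisation′ k k∈ with ∈[1‥suc]-split k∈
      ... | inj₁ k∈′ = ≈-trans (∏^-cong k (λ x x∈ → old (ℕ.≤-trans (proj₂ x∈) (proj₂ k∈′))) (λ _ _ → refl))
                               (factorisation k k∈′)
      ... | inj₂ refl = ≈-trans (⊛-cong (∏^-cong N (λ x x∈ → old (proj₂ x∈)) (λ _ _ → refl))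
                                        (≈-trans (⊛^-congˡ 𝟙[ d ∣ d ] new) (≈-reflexive (cong (Ψ ⊛^_) (𝟙-yes (d ∣? d) ∣-refl)))))
                                (≈-trans (⊛-congˡ P (⊛-identityʳ Ψ)) P⊛Ψ≈1-X^)

  cyclotomicFamily : ∀ N → ∃ λ Φ → IsCyclotomicFamily Φ N
  cyclotomicFamily zero = (λ _ → 0ₛ) , record
    { degree = λ x → ⊥-elim ∘ ∉[1‥0]
    ; coeff₀ = λ x → ⊥-elim ∘ ∉[1‥0]
    ; factorisation = λ k → ⊥-elim ∘ ∉[1‥0]
    }
  cyclotomicFamily (suc N) = _ , Extension.extended (proj₂ (cyclotomicFamily N))

module SeriesLink where

  open import Data.Bool using (if_then_else_)
  open import Data.List using (List; []; _∷_)
  open import Data.Nat as ℕ using (ℕ; zero; suc; _∸_; _≤_; _<_; _<?_; _≡ᵇ_; _%_)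
  import Data.Nat.Properties as ℕ
  open import Data.Nat.DivMod using (m<n⇒m%n≡m; [m+n]%n≡m%n)
  open import Data.Rational using (1ℚ; _+_; -_)
  open import Data.Rational.Properties using (+-identityʳ; +-inverseʳ)
  open import Function using (_∘_)
  open import Relation.Binary.PropositionalEquality
  open import Relation.Nullary using (yes; no)

  open import Defs using (Series; sumTo; conv; oneSeries; geom; invProd; toℚ)
  open NatToRational using (toℚ-+; toℚ-*)
  open PowerSeries
  open Binomial using (1-X^_)
  open Solver using (solve; _:=_; _:*_; _:-_; con)

  toPowerSeries : Series → PowerSeries
  toPowerSeries f k = toℚ (f k)

  private
    sumTo-suc : ∀ k (h : ℕ → ℕ) → sumTo (suc k) h ≡ h 0 ℕ.+ sumTo k (h ∘ suc)
    sumTo-suc zero h = refl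
    sumTo-suc (suc k) h = trans (cong (ℕ._+ h (suc (suc k))) (sumTo-suc k h)) (ℕ.+-assoc (h 0) (sumTo k (h ∘ suc)) _)

  toPowerSeries-conv : ∀ f g → toPowerSeries (conv f g) ≈ toPowerSeries f ⊛ toPowerSeries g
  toPowerSeries-conv f g zero = toℚ-* (f 0) (g 0)
  toPowerSeries-conv f g (suc k) =
    trans (cong toℚ (sumTo-suc k (λ i → f i ℕ.* g (suc k ∸ i))))
          (trans (toℚ-+ (f 0 ℕ.* g (suc k)) (conv (f ∘ suc) g k))
                 (cong₂ _+_ (toℚ-* (f 0) (g (suc k))) (toPowerSeries-conv (f ∘ suc) g k)))

  toPowerSeries-oneSeries : toPowerSeries oneSeries ≈ 1ₛ
  toPowerSeries-oneSeries zero = refl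
  toPowerSeries-oneSeries (suc k) = refl

  [1-X^_]⁻¹ : ℕ → PowerSeries
  [1-X^ zero ]⁻¹ = 1ₛ
  [1-X^ suc p ]⁻¹ = toPowerSeries (geom (suc p))

  1-X^-⊛-[1-X^]⁻¹ : ∀ p → 1 ≤ p → 1-X^ p ⊛ [1-X^ p ]⁻¹ ≈ 1ₛ
  1-X^-⊛-[1-X^]⁻¹ p@(suc p-1) _ k = begin
    (1-X^ p ⊛ G) k                ≡⟨ solve 2 (λ M G → (con 1ℚ :- M) :* G := G :- M :* G) ≈-refl (X^ p) G k ⟩
    G k + - (X^ p ⊛ G) k          ≡⟨ coefficient k ⟩
    1ₛ k                          ∎
    where
    open ≡-Reasoning
    G : PowerSeries
    G = [1-X^ p ]⁻¹
    periodic : ∀ i → G (p ℕ.+ i) ≡ G i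
    periodic i = trans (cong (λ r → toℚ (if r % p ≡ᵇ 0 then 1 else 0)) (ℕ.+-comm p i))
                       (cong (λ r → toℚ (if r ≡ᵇ 0 then 1 else 0)) ([m+n]%n≡m%n i p))
    coefficient : ∀ k → G k + - (X^ p ⊛ G) k ≡ 1ₛ k
    coefficient k with k <? p
    ... | yes k<p = trans (cong (λ c → G k + - c) (X^-⊛-below p G k k<p)) (trans (+-identityʳ (G k)) (below k k<p))
      where
      below : ∀ k → k < p → G k ≡ 1ₛ k
      below zero _ = refl
      below (suc k) k<p = cong (λ r → toℚ (if r ≡ᵇ 0 then 1 else 0)) (m<n⇒m%n≡m k<p)
    ... | no k≮p with ℕ.m+[n∸m]≡n (ℕ.≮⇒≥ k≮p)
    ...   | p+i≡k = subst (λ k → G k + - (X^ p ⊛ G) k ≡ 1ₛ k) p+i≡k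
              (trans (cong₂ (λ a b → a + - b) (periodic (k ∸ p)) (X^-⊛-shifted p G (k ∸ p))) (+-inverseʳ (G (k ∸ p))))

  partitionSeries : List ℕ → PowerSeries
  partitionSeries l = toPowerSeries (invProd l)

  partitionSeries-∷ : ∀ p ps → 1 ≤ p → partitionSeries (p ∷ ps) ≈ [1-X^ p ]⁻¹ ⊛ partitionSeries ps
  partitionSeries-∷ (suc p) ps _ = toPowerSeries-conv (geom (suc p)) (invProd ps)

  partitionSeries-[] : partitionSeries [] ≈ 1ₛ
  partitionSeries-[] = toPowerSeries-oneSeries

module DivisibleParts where

  open import Data.Empty using (⊥-elim)
  open import Data.List using (List; []; _∷_; map)
  open import Data.List.Relation.Unary.All using (All; []; _∷_)
  import Data.List.Relation.Unary.All as All
  open import Data.Nat as ℕ using (ℕ; zero; suc; _+_; _*_; _≤_; _<_; z≤n)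
  import Data.Nat.Properties as ℕ
  open import Data.Nat.Divisibility using (_∣_; _∣?_; divides; ∣⇒≤)
  open import Data.Nat.ListAction using (sum)
  open import Function using (_∘_)
  open import Algebra.Properties.CommutativeSemigroup ℕ.+-commutativeSemigroup using (x∙yz≈y∙xz)
  open import Relation.Binary.PropositionalEquality
  open import Relation.Nullary using (Dec; yes; no)

  open RangeSum using (𝟙)
  open Totient using (𝟙[_∣_])

  countDivisible : ℕ → List ℕ → ℕ
  countDivisible j l = sum (map (λ p → 𝟙[ j ∣ p ]) l)

  sumDivisible : ℕ → List ℕ → ℕ
  sumDivisible j [] = 0
  sumDivisible j (p ∷ ps) = 𝟙[ j ∣ p ] * p + sumDivisible j ps

  consUnless : ∀ {a} {A : Set a} {p} {P : Set p} → Dec P → A → List A → List A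
  consUnless (yes _) x xs = xs
  consUnless (no _) x xs = x ∷ xs

  dropDivisible : ℕ → List ℕ → List ℕ
  dropDivisible j [] = []
  dropDivisible j (p ∷ ps) = consUnless (j ∣? p) p (dropDivisible j ps)

  -- The proofs below generalise over the decision j ∣? p, so that 𝟙[ j ∣ p ] and dropDivisible
  -- reduce together.

  sum≡sumDivisible+sumDropDivisible : ∀ j l → sum l ≡ sumDivisible j l + sum (dropDivisible j l)
  sum≡sumDivisible+sumDropDivisible j [] = refl
  sum≡sumDivisible+sumDropDivisible j (p ∷ ps) = step (j ∣? p)
    where
    IH : sum ps ≡ sumDivisible j ps + sum (dropDivisible j ps)
    IH = sum≡sumDivisible+sumDropDivisible j ps
    step : (j∣?p : Dec (j ∣ p)) →
           p + sum ps ≡ 𝟙 j∣?p * p + sumDivisible j ps + sum (consUnless j∣?p p (dropDivisible j ps))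
    step (yes _) = begin
      p + sum ps                                            ≡⟨ cong (p +_) IH ⟩
      p + (sumDivisible j ps + sum (dropDivisible j ps))    ≡⟨ ℕ.+-assoc p _ _ ⟨
      p + sumDivisible j ps + sum (dropDivisible j ps)      ≡⟨ cong (λ x → x + sumDivisible j ps + _) (ℕ.+-identityʳ p) ⟨
      1 * p + sumDivisible j ps + sum (dropDivisible j ps)  ∎
      where open ≡-Reasoning
    step (no _) = trans (cong (p +_) IH) (x∙yz≈y∙xz p (sumDivisible j ps) (sum (dropDivisible j ps)))

  All-dropDivisible : ∀ {P : ℕ → Set} j l → All P l → All P (dropDivisible j l)
  All-dropDivisible j [] [] = []
  All-dropDivisible {P} j (p ∷ ps) (Pp ∷ Pps) = step (j ∣? p)
    where
    step : (j∣?p : Dec (j ∣ p)) → All P (consUnless j∣?p p (dropDivisible j ps))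
    step (yes _) = All-dropDivisible j ps Pps
    step (no _) = Pp ∷ All-dropDivisible j ps Pps

  countDivisible*j≤sumDivisible : ∀ j l → All (1 ≤_) l → countDivisible j l * j ≤ sumDivisible j l
  countDivisible*j≤sumDivisible j [] [] = z≤n
  countDivisible*j≤sumDivisible j (p ∷ ps) (1≤p ∷ 1≤ps) = step (j ∣? p)
    where
    IH : countDivisible j ps * j ≤ sumDivisible j ps
    IH = countDivisible*j≤sumDivisible j ps 1≤ps
    step : (j∣?p : Dec (j ∣ p)) → (𝟙 j∣?p + countDivisible j ps) * j ≤ 𝟙 j∣?p * p + sumDivisible j ps
    step (yes j∣p) = ℕ.+-mono-≤ (ℕ.≤-trans (∣⇒≤ {{ℕ.>-nonZero 1≤p}} j∣p) (ℕ.≤-reflexive (sym (ℕ.+-identityʳ p)))) IH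
    step (no _) = IH

  sumDivisible≤sum : ∀ j l → sumDivisible j l ≤ sum l
  sumDivisible≤sum j l = ℕ.≤-trans (ℕ.m≤m+n (sumDivisible j l) _) (ℕ.≤-reflexive (sym (sum≡sumDivisible+sumDropDivisible j l)))

  private
    positiveMultiple<double : ∀ {p j} t → 1 ≤ p → p ≡ t * j → p < j + j → p ≡ j
    positiveMultiple<double zero 1≤p p≡0 _ = ⊥-elim (ℕ.<-irrefl (sym p≡0) 1≤p)
    positiveMultiple<double {j = j} (suc zero) _ p≡j+0 _ = trans p≡j+0 (ℕ.+-identityʳ j)
    positiveMultiple<double {j = j} (suc (suc t)) _ p≡j+j+tj p<2j = ⊥-elim (ℕ.<-irrefl refl (ℕ.<-≤-trans p<2j
      (ℕ.≤-trans (ℕ.+-monoʳ-≤ j (ℕ.m≤m+n j (t * j))) (ℕ.≤-reflexive (sym p≡j+j+tj)))))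

  divisibleParts≡ : ∀ j l → All (1 ≤_) l → sumDivisible j l < suc (countDivisible j l) * j →
                    All (λ p → j ∣ p → p ≡ j) l
  divisibleParts≡ j [] [] _ = []
  divisibleParts≡ j (p ∷ ps) (1≤p ∷ 1≤ps) bound = step (j ∣? p) bound
    where
    c s : ℕ
    c = countDivisible j ps
    s = sumDivisible j ps
    c*j≤s : c * j ≤ s
    c*j≤s = countDivisible*j≤sumDivisible j ps 1≤ps
    step : (j∣?p : Dec (j ∣ p)) → 𝟙 j∣?p * p + s < suc (𝟙 j∣?p + c) * j → All (λ p → j ∣ p → p ≡ j) (p ∷ ps)
    step (no j∤p) s<[1+c]j = (⊥-elim ∘ j∤p) ∷ divisibleParts≡ j ps 1≤ps s<[1+c]j
    step (yes (divides t p≡tj)) p+s<[2+c]j = (λ _ → p≡j) ∷ divisibleParts≡ j ps 1≤ps s<[1+c]j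
      where
      p<2j : p < j + j
      p<2j = ℕ.+-cancelʳ-< (c * j) p (j + j) (begin-strict
        p + c * j          ≤⟨ ℕ.+-monoʳ-≤ p c*j≤s ⟩
        p + s              ≡⟨ cong (_+ s) (ℕ.+-identityʳ p) ⟨
        1 * p + s          <⟨ p+s<[2+c]j ⟩
        j + (j + c * j)    ≡⟨ ℕ.+-assoc j j (c * j) ⟨
        j + j + c * j      ∎)
        where open ℕ.≤-Reasoning
      p≡j : p ≡ j
      p≡j = positiveMultiple<double t 1≤p p≡tj p<2j
      s<[1+c]j : s < suc c * j
      s<[1+c]j = ℕ.+-cancelˡ-< j s (suc c * j) (subst (λ x → x + s < j + suc c * j) (trans (ℕ.+-identityʳ p) p≡j) p+s<[2+c]j)

  sumDivisible≡ : ∀ j l → All (λ p → j ∣ p → p ≡ j) l → sumDivisible j l ≡ countDivisible j l * j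
  sumDivisible≡ j [] [] = refl
  sumDivisible≡ j (p ∷ ps) (p≡j ∷ ps≡j) = step (j ∣? p)
    where
    step : (j∣?p : Dec (j ∣ p)) → 𝟙 j∣?p * p + sumDivisible j ps ≡ (𝟙 j∣?p + countDivisible j ps) * j
    step (yes j∣p) = cong₂ _+_ (trans (ℕ.*-identityˡ p) (p≡j j∣p)) (sumDivisible≡ j ps ps≡j)
    step (no _) = sumDivisible≡ j ps ps≡j

  All-≤-sum : ∀ l → All (_≤ sum l) l
  All-≤-sum [] = []
  All-≤-sum (p ∷ ps) = ℕ.m≤m+n p (sum ps) ∷ All.map (λ q≤ → ℕ.≤-trans q≤ (ℕ.m≤n+m (sum ps) p)) (All-≤-sum ps)

module PartitionSeries where

  open import Data.List using (List; []; _∷_)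
  open import Data.List.Relation.Unary.All using (All; []; _∷_)
  open import Data.Nat as ℕ using (ℕ; suc; _≤_)
  open import Data.Nat.Divisibility using (_∣_; _∣?_)
  open import Data.Nat.ListAction using (sum)
  open import Relation.Binary.PropositionalEquality
  import Relation.Binary.Reasoning.Setoid as SetoidReasoning
  open import Relation.Nullary using (Dec; yes; no)

  open PowerSeries
  open Polynomial
  open Binomial
  open RangeSum using (𝟙; _∈[1‥_])
  open RangeProduct
  open Cyclotomic
  open SeriesLink
  open DivisibleParts
  open Solver using (solve; _:=_; _:*_)

  ∏1-X^ : List ℕ → PowerSeries
  ∏1-X^ [] = 1ₛ
  ∏1-X^ (p ∷ ps) = 1-X^ p ⊛ ∏1-X^ ps

  ∏1-X^-⊛-partitionSeries : ∀ l → All (1 ≤_) l → ∏1-X^ l ⊛ partitionSeries l ≈ 1ₛ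
  ∏1-X^-⊛-partitionSeries [] [] = ≈-trans (⊛-identityˡ (partitionSeries [])) partitionSeries-[]
  ∏1-X^-⊛-partitionSeries (p ∷ ps) (1≤p ∷ 1≤ps) = begin
    1-X^ p ⊛ ∏1-X^ ps ⊛ partitionSeries (p ∷ ps)
      ≈⟨ ⊛-congˡ (1-X^ p ⊛ ∏1-X^ ps) (partitionSeries-∷ p ps 1≤p) ⟩
    1-X^ p ⊛ ∏1-X^ ps ⊛ ([1-X^ p ]⁻¹ ⊛ partitionSeries ps)
      ≈⟨ solve 4 (λ F P G f → F :* P :* (G :* f) := (F :* G) :* (P :* f)) ≈-refl
               (1-X^ p) (∏1-X^ ps) [1-X^ p ]⁻¹ (partitionSeries ps) ⟩
    (1-X^ p ⊛ [1-X^ p ]⁻¹) ⊛ (∏1-X^ ps ⊛ partitionSeries ps)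
      ≈⟨ ⊛-cong (1-X^-⊛-[1-X^]⁻¹ p 1≤p) (∏1-X^-⊛-partitionSeries ps 1≤ps) ⟩
    1ₛ ⊛ 1ₛ
      ≈⟨ ⊛-identityˡ 1ₛ ⟩
    1ₛ ∎
    where open SetoidReasoning ≈-setoid

  HasDegree-∏1-X^ : ∀ l → All (1 ≤_) l → HasDegree (∏1-X^ l) (sum l)
  HasDegree-∏1-X^ [] [] = HasDegree-1ₛ
  HasDegree-∏1-X^ (p ∷ ps) (1≤p ∷ 1≤ps) = HasDegree-⊛ (HasDegree-1-X^ p 1≤p) (HasDegree-∏1-X^ ps 1≤ps)

  partitionSeries-split : ∀ j l → All (1 ≤_) l → All (λ p → j ∣ p → p ≡ j) l →
    partitionSeries l ≈ [1-X^ j ]⁻¹ ⊛^ countDivisible j l ⊛ partitionSeries (dropDivisible j l)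
  partitionSeries-split j [] [] [] = ≈-sym (⊛-identityˡ (partitionSeries []))
  partitionSeries-split j (p ∷ ps) (1≤p ∷ 1≤ps) (p≡j ∷ ps≡j) = step (j ∣? p)
    where
    open SetoidReasoning ≈-setoid
    G rest : PowerSeries
    G = [1-X^ j ]⁻¹
    rest = partitionSeries (dropDivisible j ps)
    c : ℕ
    c = countDivisible j ps
    IH : partitionSeries ps ≈ G ⊛^ c ⊛ rest
    IH = partitionSeries-split j ps 1≤ps ps≡j
    step : (j∣?p : Dec (j ∣ p)) →
           partitionSeries (p ∷ ps) ≈ G ⊛^ (𝟙 j∣?p ℕ.+ c) ⊛ partitionSeries (consUnless j∣?p p (dropDivisible j ps))
    step (yes j∣p) = begin
      partitionSeries (p ∷ ps)      ≈⟨ partitionSeries-∷ p ps 1≤p ⟩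
      [1-X^ p ]⁻¹ ⊛ partitionSeries ps ≈⟨ ⊛-cong (≈-reflexive (cong [1-X^_]⁻¹ (p≡j j∣p))) IH ⟩
      G ⊛ (G ⊛^ c ⊛ rest)           ≈⟨ ⊛-assoc G (G ⊛^ c) rest ⟨
      G ⊛^ suc c ⊛ rest             ∎
    step (no _) = begin
      partitionSeries (p ∷ ps)         ≈⟨ partitionSeries-∷ p ps 1≤p ⟩
      [1-X^ p ]⁻¹ ⊛ partitionSeries ps ≈⟨ ⊛-congˡ [1-X^ p ]⁻¹ IH ⟩
      [1-X^ p ]⁻¹ ⊛ (G ⊛^ c ⊛ rest)    ≈⟨ solve 3 (λ A B C → A :* (B :* C) := B :* (A :* C)) ≈-refl [1-X^ p ]⁻¹ (G ⊛^ c) rest ⟩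
      G ⊛^ c ⊛ ([1-X^ p ]⁻¹ ⊛ rest)    ≈⟨ ⊛-congˡ (G ⊛^ c) (partitionSeries-∷ p (dropDivisible j ps) 1≤p) ⟨
      G ⊛^ c ⊛ partitionSeries (p ∷ dropDivisible j ps) ∎

  module _ {Φ N} (family : IsCyclotomicFamily Φ N) where
    open IsCyclotomicFamily family

    ∏1-X^≈∏^ : ∀ l → All (_∈[1‥ N ]) l → ∏1-X^ l ≈ ∏^ Φ N (λ x → countDivisible x l)
    ∏1-X^≈∏^ [] [] = ≈-sym (∏^-0 Φ N (λ _ → 0) (λ _ _ → refl))
    ∏1-X^≈∏^ (p ∷ ps) (p∈ ∷ ps∈) = begin
      1-X^ p ⊛ ∏1-X^ ps                                            ≈⟨ ⊛-cong (≈-sym (factorisation-∏^N p p∈)) (∏1-X^≈∏^ ps ps∈) ⟩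
      ∏^ Φ N (λ x → 𝟙 (x ∣? p)) ⊛ ∏^ Φ N (λ x → countDivisible x ps) ≈⟨ ∏^-+ Φ N _ _ ⟨
      ∏^ Φ N (λ x → countDivisible x (p ∷ ps))                      ∎
      where open SetoidReasoning ≈-setoid

module SpanDimension where

  open import Algebra.Bundles using (CommutativeRing)
  open import Data.Empty using (⊥-elim)
  open import Data.Fin using (Fin) renaming (zero to fzero; suc to fsuc)
  open import Data.List using (List; []; tabulate; length)
  open import Data.List.Properties using (length-tabulate)
  open import Data.List.Relation.Unary.All using ([])
  open import Data.Nat as ℕ using (ℕ; zero; suc; _≤_; z≤n; s≤s)
  open import Data.Product using (_,_; proj₁; proj₂)
  open import Data.Rational as ℚ using (ℚ; 0ℚ; 1ℚ; _+_; _*_; -_)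
  open import Data.Rational.Properties
  open import Data.Rational.Solver using (module +-*-Solver)
  open import Function using (_∘_)
  open import Relation.Binary.PropositionalEquality
  open import Relation.Nullary using (¬_)
  open import Relation.Nullary.Decidable using (decidable-stable)

  open import Algebra.Properties.Semiring.Sum (CommutativeRing.semiring +-*-commutativeRing)
    using (sum; sum-cong-≗; *-distribˡ-sum)

  open import Defs using (sumFinℚ; LinIndep; IsSpanDim; Partition; invProd)
  open PowerSeries
  open SeriesLink using (toPowerSeries; partitionSeries)
  open Span
  open +-*-Solver using (solve; _:=_; _:+_; _:*_; :-_)

  sumFinℚ≡sum : ∀ r (f : Fin r → ℚ) → sumFinℚ r f ≡ sum f
  sumFinℚ≡sum zero f = refl
  sumFinℚ≡sum (suc r) f = cong (f fzero +_) (sumFinℚ≡sum r (f ∘ fsuc))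

  LinIndep⇒LinearlyIndependent : ∀ r f → LinIndep r f → LinearlyIndependent r (toPowerSeries ∘ f)
  LinIndep⇒LinearlyIndependent r f indep c Σ≡0 = indep c (λ k → trans (sumFinℚ≡sum r _) (Σ≡0 k))

  LinearlyIndependent⇒LinIndep : ∀ r f → LinearlyIndependent r (toPowerSeries ∘ f) → LinIndep r f
  LinearlyIndependent⇒LinIndep r f indep c Σ≡0 = indep c (λ k → trans (sym (sumFinℚ≡sum r _)) (Σ≡0 k))

  private
    solveFor : ∀ c₀ c₀⁻¹ x s → c₀⁻¹ * c₀ ≡ 1ℚ → c₀ * x + s ≡ 0ℚ → x ≡ - c₀⁻¹ * s
    solveFor c₀ c₀⁻¹ x s inverse c₀x+s≡0 = begin
      x                                   ≡⟨ *-identityˡ x ⟨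
      1ℚ * x                              ≡⟨ cong (_* x) inverse ⟨
      c₀⁻¹ * c₀ * x                       ≡⟨ regroup c₀ c₀⁻¹ x s ⟩
      c₀⁻¹ * (c₀ * x + s) + - c₀⁻¹ * s    ≡⟨ cong (λ t → c₀⁻¹ * t + - c₀⁻¹ * s) c₀x+s≡0 ⟩
      c₀⁻¹ * 0ℚ + - c₀⁻¹ * s              ≡⟨ cong (_+ - c₀⁻¹ * s) (*-zeroʳ c₀⁻¹) ⟩
      0ℚ + - c₀⁻¹ * s                     ≡⟨ +-identityˡ _ ⟩
      - c₀⁻¹ * s                          ∎
      where
      open ≡-Reasoning
      regroup : ∀ c₀ c₀⁻¹ x s → c₀⁻¹ * c₀ * x ≡ c₀⁻¹ * (c₀ * x + s) + - c₀⁻¹ * s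
      regroup = solve 4 (λ c₀ c₀⁻¹ x s → c₀⁻¹ :* c₀ :* x := c₀⁻¹ :* (c₀ :* x :+ s) :+ :- c₀⁻¹ :* s) refl

  partitionFamily : ∀ {m d} → (Fin d → Partition m) → Fin d → PowerSeries
  partitionFamily ps i = partitionSeries (proj₁ (ps i))

  module _ {m d} (sd : IsSpanDim m d) where

    private
      basis : Fin d → Partition m
      basis = proj₁ (proj₁ sd)

    basisSeries : List PowerSeries
    basisSeries = tabulate (partitionFamily basis)

    length-basisSeries : length basisSeries ≡ d
    length-basisSeries = length-tabulate (partitionFamily basis)

    basis-linearlyIndependent : LinearlyIndependent d (partitionFamily basis)
    basis-linearlyIndependent = LinIndep⇒LinearlyIndependent d (λ i → invProd (proj₁ (basis i))) (proj₂ (proj₁ sd))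

    -- Otherwise μ could be added to the basis, contradicting maximality.
    ¬¬InSpan-basisSeries : (μ : Partition m) → ¬ ¬ InSpan basisSeries (partitionSeries (proj₁ μ))
    ¬¬InSpan-basisSeries μ μ∉span =
      proj₂ sd extended (LinearlyIndependent⇒LinIndep (suc d) (λ i → invProd (proj₁ (extended i))) extended-independent)
      where
      extended : Fin (suc d) → Partition m
      extended fzero = μ
      extended (fsuc i) = basis i
      f : PowerSeries
      f = partitionSeries (proj₁ μ)
      extended-independent : LinearlyIndependent (suc d) (partitionFamily extended)
      extended-independent c Σ≡0 = λ { fzero → c₀≡0 ; (fsuc i) → rest≡0 i }
        where
        S : ℕ → ℚ
        S k = sum (λ i → c (fsuc i) * partitionFamily basis i k)
        μ∈span : c fzero ≢ 0ℚ → InSpan basisSeries f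
        μ∈span c₀≢0 = InSpan-tabulate (partitionFamily basis) (λ i → - c₀⁻¹ * c (fsuc i)) (λ k →
          trans (solveFor (c fzero) c₀⁻¹ (f k) (S k) (*-inverseˡ (c fzero)) (Σ≡0 k))
                (trans (*-distribˡ-sum (- c₀⁻¹) (λ i → c (fsuc i) * partitionFamily basis i k))
                       (sum-cong-≗ (λ i → sym (*-assoc (- c₀⁻¹) (c (fsuc i)) (partitionFamily basis i k))))))
          where
          instance
            c₀-nonZero : ℚ.NonZero (c fzero)
            c₀-nonZero = ℚ.≢-nonZero c₀≢0
          c₀⁻¹ : ℚ
          c₀⁻¹ = ℚ.1/ c fzero
        c₀≡0 : c fzero ≡ 0ℚ
        c₀≡0 = decidable-stable (c fzero ≟ 0ℚ) (μ∉span ∘ μ∈span)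
        rest≡0 : ∀ i → c (fsuc i) ≡ 0ℚ
        rest≡0 = basis-linearlyIndependent (c ∘ fsuc) λ k → begin
          S k                       ≡⟨ +-identityˡ (S k) ⟨
          0ℚ + S k                  ≡⟨ cong (_+ S k) (trans (cong (_* f k) c₀≡0) (*-zeroˡ (f k))) ⟨
          c fzero * f k + S k       ≡⟨ Σ≡0 k ⟩
          0ℚ                        ∎
          where open ≡-Reasoning

  IsSpanDim-0⇒1≤ : ∀ {d} → IsSpanDim 0 d → 1 ≤ d
  IsSpanDim-0⇒1≤ {suc d} _ = s≤s z≤n
  IsSpanDim-0⇒1≤ {zero} (_ , maximal) = ⊥-elim (maximal (λ _ → [] , [] , refl) single-independent)
    where
    single-independent : LinIndep 1 (λ _ → invProd [])
    single-independent c Σ≡0 fzero = trans (sym (*-identityʳ (c fzero))) (trans (sym (+-identityʳ _)) (Σ≡0 0))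

open import Data.Nat using (ℕ; _+_; _*_; _∸_; _/_; _≤_)
open import Defs
module DimensionBound (n : ℕ) (D : ℕ → ℕ) (isSpanDim : ∀ m → m ≤ n → IsSpanDim m (D m)) where

  open import Data.Fin using (Fin)
  open import Data.List using (List; []; _∷_; map; length; _++_)
  open import Data.List.Properties using (length-++; length-map; map-id)
  open import Data.List.Relation.Unary.All using (All; []; _∷_)
  import Data.List.Relation.Unary.All as All
  open import Data.Nat as ℕ using (zero; suc; pred; _<_; z≤n; s≤s)
  import Data.Nat.Properties as ℕ
  open import Data.Nat.DivMod using (n/1≡n; m%n<n; m%n≡m∸m/n*n; m/n*n≤m; m≥n⇒m/n>0)
  open import Data.Nat.Divisibility using (_∣_)
  open import Data.Nat.ListAction using (sum)
  open import Data.Product using (_×_; _,_; proj₁; proj₂)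
  open import Relation.Binary.PropositionalEquality
  import Relation.Binary.Reasoning.Setoid as SetoidReasoning
  open import Relation.Nullary using (¬_; Dec; yes; no; _×-dec_)

  open PowerSeries
  open Polynomial
  open RangeSum
  open RangeProduct
  open Totient
  open Cyclotomic
  open SeriesLink
  open DivisibleParts
  open PartitionSeries
  open Span
  open SpanDimension

  Φ : ℕ → PowerSeries
  Φ = proj₁ (cyclotomicFamily n)

  family : IsCyclotomicFamily Φ n
  family = proj₂ (cyclotomicFamily n)

  open IsCyclotomicFamily family

  -- n = quot j * j + rem j, by pattern matching so as to agree with the terms of `correction`.
  quot rem : ℕ → ℕ
  quot zero = 0
  quot (suc i) = n / suc i
  rem zero = 0
  rem (suc i) = n ∸ suc i * (n / suc i)

  rem≤n : ∀ j → rem j ≤ n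
  rem≤n zero = z≤n
  rem≤n (suc i) = ℕ.m∸n≤m n (suc i * (n / suc i))

  quot*j+rem≡n : ∀ j → 1 ≤ j → quot j * j + rem j ≡ n
  quot*j+rem≡n (suc i) _ = trans (cong (_+ rem (suc i)) (ℕ.*-comm (n / suc i) (suc i)))
                                 (ℕ.m+[n∸m]≡n (subst (_≤ n) (ℕ.*-comm (n / suc i) (suc i)) (m/n*n≤m n (suc i))))

  n<[1+quot]*j : ∀ j → 1 ≤ j → n < suc (quot j) * j
  n<[1+quot]*j j@(suc i) _ = begin-strict
    n                         ≡⟨ quot*j+rem≡n j (s≤s z≤n) ⟨
    quot j * j + rem j        <⟨ ℕ.+-monoʳ-< (quot j * j) rem<j ⟩
    quot j * j + j            ≡⟨ ℕ.+-comm (quot j * j) j ⟩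
    suc (quot j) * j          ∎
    where
    open ℕ.≤-Reasoning
    rem<j : rem j < j
    rem<j = subst (_< j) (trans (m%n≡m∸m/n*n n j) (cong (n ∸_) (ℕ.*-comm (n / j) j))) (m%n<n n j)

  1≤quot : ∀ j → j ∈[1‥ n ] → 1 ≤ quot j
  1≤quot (suc i) (_ , j≤n) = m≥n⇒m/n>0 j≤n

  countDivisible-range : ∀ j → 1 ≤ j → countDivisible j (range n) ≡ quot j
  countDivisible-range (suc i) _ = trans (sum-map-range (λ k → 𝟙[ suc i ∣ k ]) n) (∑₁-𝟙∣ n (suc i))

  parts∈[1‥n] : (π : Partition n) → All (_∈[1‥ n ]) (proj₁ π)
  parts∈[1‥n] (l , 1≤l , sum≡n) =
    All.zipWith (λ (1≤p , p≤sum) → 1≤p , ℕ.≤-trans p≤sum (ℕ.≤-reflexive sum≡n)) (1≤l , All-≤-sum l)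

  countDivisible≤quot : (π : Partition n) → ∀ j → 1 ≤ j → countDivisible j (proj₁ π) ≤ quot j
  countDivisible≤quot (l , 1≤l , sum≡n) j 1≤j = ℕ.<⇒≤pred (ℕ.*-cancelʳ-< j _ _ (begin-strict
    countDivisible j l * j      ≤⟨ countDivisible*j≤sumDivisible j l 1≤l ⟩
    sumDivisible j l            ≤⟨ sumDivisible≤sum j l ⟩
    sum l                       ≡⟨ sum≡n ⟩
    n                           <⟨ n<[1+quot]*j j 1≤j ⟩
    suc (quot j) * j            ∎))
    where open ℕ.≤-Reasoning

  deficient? : ∀ j → Dec (D (rem j) < φ j)
  deficient? j = D (rem j) ℕ.<? φ j

  𝟙J : ℕ → ℕ
  𝟙J j = 𝟙 (deficient? j)

  C : PowerSeries
  C = ∏^ Φ n 𝟙J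

  c : ℕ
  c = ∑₁ n (λ j → 𝟙J j * φ j)

  tri : ℕ
  tri = ∑₁ n pred

  -- j = 1 is never deficient since D 0 ≥ 1 = φ 1, and φ j < j for j ≥ 2.
  c≤tri : c ≤ tri
  c≤tri = ∑₁-mono-≤ n bound
    where
    rem1≡0 : rem 1 ≡ 0
    rem1≡0 = trans (cong (n ∸_) (trans (ℕ.+-identityʳ (n / 1)) (n/1≡n n))) (ℕ.n∸n≡0 n)
    bound : ∀ j → j ∈[1‥ n ] → 𝟙J j * φ j ≤ pred j
    bound 1 _ = ℕ.≤-reflexive (cong (_* 1) (𝟙-no (deficient? 1) (λ D[rem1]<1 →
      ℕ.<-irrefl refl (ℕ.<-≤-trans D[rem1]<1
        (subst (λ r → 1 ≤ D r) (sym rem1≡0) (IsSpanDim-0⇒1≤ (isSpanDim 0 z≤n)))))))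
    bound j@(suc (suc _)) _ = begin
      𝟙J j * φ j   ≤⟨ ℕ.*-monoˡ-≤ (φ j) (𝟙-≤1 (deficient? j)) ⟩
      1 * φ j      ≡⟨ ℕ.*-identityˡ (φ j) ⟩
      φ j          ≤⟨ φ≤pred j (s≤s (s≤s z≤n)) ⟩
      pred j       ∎
      where open ℕ.≤-Reasoning

  Q : PowerSeries
  Q = ∏1-X^ (range n)

  Q≈∏^quot : Q ≈ ∏^ Φ n quot
  Q≈∏^quot = ≈-trans (∏1-X^≈∏^ family (range n) (All-range n))
                     (∏^-cong-exp Φ n (λ j j∈ → countDivisible-range j (proj₁ j∈)))

  HasDegree-Q : HasDegree Q (tri + n)
  HasDegree-Q = subst (HasDegree Q) sum≡ (HasDegree-∏1-X^ (range n) (All.map proj₁ (All-range n)))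
    where
    sum≡ : sum (range n) ≡ tri + n
    sum≡ = trans (cong sum (sym (map-id (range n)))) (trans (sum-map-range (λ x → x) n) (∑₁-id n))

  Q/C : PowerSeries
  Q/C = ∏^ Φ n (λ j → quot j ∸ 𝟙J j)

  Q/C⊛C≈Q : Q/C ⊛ C ≈ Q
  Q/C⊛C≈Q = ≈-trans (≈-sym (∏^-+ Φ n (λ j → quot j ∸ 𝟙J j) 𝟙J))
    (≈-trans (∏^-cong-exp Φ n (λ j j∈ → ℕ.m∸n+n≡m (ℕ.≤-trans (𝟙-≤1 (deficient? j)) (1≤quot j j∈))))
             (≈-sym Q≈∏^quot))

  C/Q : PowerSeries
  C/Q = C ⊛ partitionSeries (range n)

  Q/C⊛C/Q≈1 : Q/C ⊛ C/Q ≈ 1ₛ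
  Q/C⊛C/Q≈1 = ≈-trans (≈-sym (⊛-assoc Q/C C (partitionSeries (range n))))
    (≈-trans (⊛-congʳ (partitionSeries (range n)) Q/C⊛C≈Q)
             (∏1-X^-⊛-partitionSeries (range n) (All.map proj₁ (All-range n))))

  T : ℕ
  T = tri ∸ c

  module Generic (π : Partition n)
                 (few : ∀ j → j ∈[1‥ n ] → 𝟙J j ≡ 1 → countDivisible j (proj₁ π) < quot j) where

    private
      l : List ℕ
      l = proj₁ π
      1≤l : All (1 ≤_) l
      1≤l = proj₁ (proj₂ π)

    e : ℕ → ℕ
    e j = quot j ∸ 𝟙J j ∸ countDivisible j l

    P : PowerSeries
    P = ∏^ Φ n e

    private
      countDivisible≤ : ∀ j → j ∈[1‥ n ] → countDivisible j l ≤ quot j ∸ 𝟙J j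
      countDivisible≤ j j∈ = bound (deficient? j) (few j j∈)
        where
        bound : (J? : Dec (D (rem j) < φ j)) → (𝟙 J? ≡ 1 → countDivisible j l < quot j) →
                countDivisible j l ≤ quot j ∸ 𝟙 J?
        bound (yes _) few-j = ℕ.∸-monoˡ-≤ 1 (few-j refl)
        bound (no _) _ = countDivisible≤quot π j (proj₁ j∈)

    Q/C≈∏1-X^⊛P : Q/C ≈ ∏1-X^ l ⊛ P
    Q/C≈∏1-X^⊛P = begin
      Q/C                                                 ≈⟨ ∏^-cong-exp Φ n (λ j j∈ → sym (ℕ.m+[n∸m]≡n (countDivisible≤ j j∈))) ⟩
      ∏^ Φ n (λ j → countDivisible j l + e j)             ≈⟨ ∏^-+ Φ n (λ j → countDivisible j l) e ⟩
      ∏^ Φ n (λ j → countDivisible j l) ⊛ P               ≈⟨ ⊛-congʳ P (∏1-X^≈∏^ family l (parts∈[1‥n] π)) ⟨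
      ∏1-X^ l ⊛ P                                         ∎
      where open SetoidReasoning ≈-setoid

    partitionSeries≈P⊛C/Q : partitionSeries l ≈ P ⊛ C/Q
    partitionSeries≈P⊛C/Q = begin
      f                              ≈⟨ ⊛-identityʳ f ⟨
      f ⊛ 1ₛ                         ≈⟨ ⊛-congˡ f Q/C⊛C/Q≈1 ⟨
      f ⊛ (Q/C ⊛ C/Q)                ≈⟨ ⊛-congˡ f (⊛-congʳ C/Q Q/C≈∏1-X^⊛P) ⟩
      f ⊛ (∏1-X^ l ⊛ P ⊛ C/Q)        ≈⟨ solve 4 (λ f F P Y → f :* (F :* P :* Y) := (F :* f) :* (P :* Y))
                                                ≈-refl f (∏1-X^ l) P C/Q ⟩
      (∏1-X^ l ⊛ f) ⊛ (P ⊛ C/Q)      ≈⟨ ⊛-congʳ (P ⊛ C/Q) (∏1-X^-⊛-partitionSeries l 1≤l) ⟩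
      1ₛ ⊛ (P ⊛ C/Q)                 ≈⟨ ⊛-identityˡ (P ⊛ C/Q) ⟩
      P ⊛ C/Q                        ∎
      where
      open SetoidReasoning ≈-setoid
      open Solver using (solve; _:=_; _:*_)
      f : PowerSeries
      f = partitionSeries l

    Deg≤-P : Deg≤ P T
    Deg≤-P = subst (Deg≤ P) (ℕ.+-cancelʳ-≡ c _ _ dP+c≡T+c) (proj₁ P∈dP)
      where
      open Solver using (solve; _:=_; _:*_)
      P∈dP : HasDegree P (∑₁ n (λ j → e j * φ j))
      P∈dP = HasDegree-∏^ Φ n e φ degree
      dP+c+n≡tri+n : ∑₁ n (λ j → e j * φ j) + c + n ≡ tri + n
      dP+c+n≡tri+n = HasDegree-unique
        (HasDegree-resp-≈ (≈-trans (solve 3 (λ P C F → P :* C :* F := (F :* P) :* C) ≈-refl P C (∏1-X^ l))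
                                   (≈-trans (⊛-congʳ C (≈-sym Q/C≈∏1-X^⊛P)) Q/C⊛C≈Q))
           (subst (HasDegree (P ⊛ C ⊛ ∏1-X^ l)) (cong (∑₁ n (λ j → e j * φ j) + c +_) (proj₂ (proj₂ π)))
             (HasDegree-⊛ (HasDegree-⊛ P∈dP (HasDegree-∏^ Φ n 𝟙J φ degree)) (HasDegree-∏1-X^ l 1≤l))))
        HasDegree-Q
      dP+c≡T+c : ∑₁ n (λ j → e j * φ j) + c ≡ T + c
      dP+c≡T+c = trans (ℕ.+-cancelʳ-≡ n _ _ dP+c+n≡tri+n) (sym (ℕ.m∸n+n≡m c≤tri))

    InSpan-generic : InSpan (shiftsOf C/Q (suc T)) (partitionSeries l)
    InSpan-generic = InSpan-resp-≈ (shiftsOf C/Q (suc T)) (≈-sym partitionSeries≈P⊛C/Q)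
                                   (InSpan-shiftsOf C/Q (suc T) P Deg≤-P)

  K : ℕ → PowerSeries
  K j = [1-X^ j ]⁻¹ ⊛^ quot j

  basisBlock : ℕ → List PowerSeries
  basisBlock j = map (K j ⊛_) (basisSeries (isSpanDim (rem j) (rem≤n j)))

  module Special (π : Partition n) {j} (j∈ : j ∈[1‥ n ]) (many : quot j ≤ countDivisible j (proj₁ π)) where

    private
      l : List ℕ
      l = proj₁ π
      1≤l : All (1 ≤_) l
      1≤l = proj₁ (proj₂ π)
      sum≡n : sum l ≡ n
      sum≡n = proj₂ (proj₂ π)

    count≡quot : countDivisible j l ≡ quot j
    count≡quot = ℕ.≤-antisym (countDivisible≤quot π j (proj₁ j∈)) many

    divisibleParts≡j : All (λ p → j ∣ p → p ≡ j) l
    divisibleParts≡j = divisibleParts≡ j l 1≤l (begin-strict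
      sumDivisible j l                ≤⟨ sumDivisible≤sum j l ⟩
      sum l                           ≡⟨ sum≡n ⟩
      n                               <⟨ n<[1+quot]*j j (proj₁ j∈) ⟩
      suc (quot j) * j                ≡⟨ cong (λ m → suc m * j) count≡quot ⟨
      suc (countDivisible j l) * j    ∎)
      where open ℕ.≤-Reasoning

    remainder : Partition (rem j)
    remainder = dropDivisible j l , All-dropDivisible j l 1≤l , ℕ.+-cancelˡ-≡ (quot j * j) _ _ (begin
      quot j * j + sum (dropDivisible j l)             ≡⟨ cong (λ m → m * j + sum (dropDivisible j l)) count≡quot ⟨
      countDivisible j l * j + sum (dropDivisible j l) ≡⟨ cong (_+ sum (dropDivisible j l)) (sumDivisible≡ j l divisibleParts≡j) ⟨
      sumDivisible j l + sum (dropDivisible j l)       ≡⟨ sum≡sumDivisible+sumDropDivisible j l ⟨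
      sum l                                            ≡⟨ sum≡n ⟩
      n                                                ≡⟨ quot*j+rem≡n j (proj₁ j∈) ⟨
      quot j * j + rem j                               ∎)
      where open ≡-Reasoning

    partitionSeries≈K⊛ : partitionSeries l ≈ K j ⊛ partitionSeries (proj₁ remainder)
    partitionSeries≈K⊛ = ≈-trans (partitionSeries-split j l 1≤l divisibleParts≡j)
      (⊛-congʳ (partitionSeries (proj₁ remainder)) (≈-reflexive (cong ([1-X^ j ]⁻¹ ⊛^_) count≡quot)))

    ¬¬InSpan-special : ¬ ¬ InSpan (basisBlock j) (partitionSeries l)
    ¬¬InSpan-special ∉span = ¬¬InSpan-basisSeries (isSpanDim (rem j) (rem≤n j)) remainder λ μ∈span →
      ∉span (InSpan-resp-≈ (basisBlock j) (≈-sym partitionSeries≈K⊛)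
                           (InSpan-map-⊛ (K j) (basisSeries (isSpanDim (rem j) (rem≤n j))) μ∈span))

  block : ℕ → List PowerSeries
  block j = optionally (deficient? j) (basisBlock j)

  spanningList : List PowerSeries
  spanningList = shiftsOf C/Q (suc T) ++ concat₁ n block

  ¬¬InSpan-spanningList : (π : Partition n) → ¬ ¬ InSpan spanningList (partitionSeries (proj₁ π))
  ¬¬InSpan-spanningList π with ℕ.anyUpTo? special? (suc n)
    where
    special? : ∀ j → Dec (1 ≤ j × D (rem j) < φ j × quot j ≤ countDivisible j (proj₁ π))
    special? j = (1 ℕ.≤? j) ×-dec (deficient? j ×-dec (quot j ℕ.≤? countDivisible j (proj₁ π)))
  ... | yes (j , s≤s j≤n , 1≤j , deficient , many) = λ ∉span →
    Special.¬¬InSpan-special π (1≤j , j≤n) many (λ ∈block → ∉span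
      (InSpan-++ʳ (shiftsOf C/Q (suc T)) (concat₁ n block) {partitionSeries (proj₁ π)}
        (InSpan-concat₁ n block (1≤j , j≤n)
          (InSpan-optionally (deficient? j) (basisBlock j) deficient ∈block))))
  ... | no ¬special = λ ∉span →
    ∉span (InSpan-++ˡ (shiftsOf C/Q (suc T)) (concat₁ n block) {partitionSeries (proj₁ π)} (Generic.InSpan-generic π few))
    where
    few : ∀ j → j ∈[1‥ n ] → 𝟙J j ≡ 1 → countDivisible j (proj₁ π) < quot j
    few j (1≤j , j≤n) 𝟙J≡1 = ℕ.≰⇒> λ many → ¬special (j , s≤s j≤n , 1≤j , 𝟙≡1⇒ (deficient? j) 𝟙J≡1 , many)

  D[n]≤length : D n ≤ length spanningList
  D[n]≤length = ¬¬InSpan∧linearlyIndependent⇒≤length spanningList (partitionFamily basis)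
    (λ i → ¬¬InSpan-spanningList (basis i)) (basis-linearlyIndependent (isSpanDim n ℕ.≤-refl))
    where
    basis : Fin (D n) → Partition n
    basis = proj₁ (proj₁ (isSpanDim n ℕ.≤-refl))

  length-spanningList : length spanningList ≡ suc T + ∑₁ n (λ j → 𝟙J j * D (rem j))
  length-spanningList = trans (length-++ (shiftsOf C/Q (suc T)))
    (cong₂ _+_ (length-shiftsOf C/Q (suc T)) (trans (length-concat₁ n block) (∑₁-cong n (λ j _ → length-block j))))
    where
    length-block : ∀ j → length (block j) ≡ 𝟙J j * D (rem j)
    length-block j = trans (length-optionally (deficient? j) (basisBlock j))
      (cong (𝟙J j *_) (trans (length-map (K j ⊛_) (basisSeries (isSpanDim (rem j) (rem≤n j))))
                            (length-basisSeries (isSpanDim (rem j) (rem≤n j)))))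

  correction≡∑₁ : correction D n ≡ ∑₁ n (λ j → φ j ∸ D (rem j))
  correction≡∑₁ = trans (sum-map-upTo _ n) (∑₁-cong n (λ { (suc i) _ → refl }))

  length+correction≡ : length spanningList + correction D n ≡ tri + 1
  length+correction≡ = begin
    length spanningList + correction D n                ≡⟨ cong₂ _+_ length-spanningList correction≡∑₁ ⟩
    suc T + ∑₁ n blockSize + ∑₁ n excess                ≡⟨ ℕ.+-assoc (suc T) _ _ ⟩
    suc T + (∑₁ n blockSize + ∑₁ n excess)              ≡⟨ cong (suc T +_) (ℕ.+-comm (∑₁ n blockSize) _) ⟩
    suc T + (∑₁ n excess + ∑₁ n blockSize)              ≡⟨ cong (suc T +_) (∑₁-distrib-+ n excess blockSize) ⟨
    suc T + ∑₁ n (λ j → excess j + blockSize j)         ≡⟨ cong (suc T +_) (∑₁-cong n (λ j _ → excess+blockSize j)) ⟩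
    suc (T + c)                                         ≡⟨ cong suc (ℕ.m∸n+n≡m c≤tri) ⟩
    suc tri                                             ≡⟨ ℕ.+-comm 1 tri ⟩
    tri + 1                                             ∎
    where
    open ≡-Reasoning
    excess blockSize : ℕ → ℕ
    excess j = φ j ∸ D (rem j)
    blockSize j = 𝟙J j * D (rem j)
    excess+blockSize : ∀ j → excess j + blockSize j ≡ 𝟙J j * φ j
    excess+blockSize j = split (deficient? j)
      where
      split : (J? : Dec (D (rem j) < φ j)) → excess j + 𝟙 J? * D (rem j) ≡ 𝟙 J? * φ j
      split (yes D<φ) = trans (cong (excess j +_) (ℕ.+-identityʳ (D (rem j))))
                              (trans (ℕ.m∸n+n≡m (ℕ.<⇒≤ D<φ)) (sym (ℕ.+-identityʳ (φ j))))
      split (no D≮φ) = trans (ℕ.+-identityʳ (excess j)) (ℕ.m≤n⇒m∸n≡0 (ℕ.≮⇒≥ D≮φ))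

import Data.Nat.Properties as ℕ
open import Data.List using (length)
open import Relation.Binary.PropositionalEquality using (cong)
open RangeSum using (∑₁-pred)

-- The bound also holds for n = 0.
mainTheorem3 : (n : ℕ) → 1 ≤ n → (D : ℕ → ℕ) → (∀ m → m ≤ n → IsSpanDim m (D m)) →
    D n + correction D n ≤ (n * (n ∸ 1)) / 2 + 1
mainTheorem3 n _ D isSpanDim = begin
  D n + correction D n                  ≤⟨ ℕ.+-monoˡ-≤ (correction D n) D[n]≤length ⟩
  length spanningList + correction D n  ≡⟨ length+correction≡ ⟩
  tri + 1                               ≡⟨ cong (_+ 1) (∑₁-pred n) ⟩
  n * (n ∸ 1) / 2 + 1                   ∎
  where
  open ℕ.≤-Reasoning
  open DimensionBound n D isSpanDim
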